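{- Let $n\ge1$, $\tau\in\mathcal B_n$, and let $j$ be an integer with $0\le j\le\lfloor n/2\rfloor$. If $\kappa$ and $\kappa'$ are principal colorings of $\tau$ each having exactly $j$ white vertices in the left column $\{v_1,\dotsc,v_n\}$, then $\alpha(\tau,\kappa)=\alpha(\tau,\kappa')$ and $\beta(\tau,\kappa)=\beta(\tau,\kappa')$.
   Context: Place $2n$ vertices in two columns: the left column $v_1,\dotsc,v_n$ from bottom to top and the right column $v_{n+1},\dotsc,v_{2n}$ from top to bottom, so $v_i$ and $v_{2n+1-i}$ lie at the same height $i$. The Temperley–Lieb algebra $T_n(\xi)$ is the $\mathbb C$-algebra generated by $t_1,\dotsc,t_{n-1}$ with relations $t_i^2=\xi t_i$, $t_it_jt_i=t_i$ if $|i-j|=1$, $t_it_j=t_jt_i$ if $|i-j|\ge2$. $\mathcal B_n$ is the monoid generated by $t_1,\dots,t_{n-1}$ when $\xi=1$ (a basis of $T_n(\xi)$). Each $\tau\in\mathcal B_n$ is identified with its Kauffman diagram, a noncrossing perfect matching of the $2n$ vertices: the identity has edges $v_i$—$v_{2n+1-i}$; $t_i$ has edges $v_i$—$v_{i+1}$, $v_{2n+1-i}$—$v_{2n-i}$ and $v_k$—$v_{2n+1-k}$ for $k\neq i,i+1$; products correspond to side-by-side concatenation of diagrams with closed loops removed. $\hat\tau$ is the multigraph obtained from $\tau$ by adding an edge $v_i$—$v_{2n+1-i}$ for each $i\in[n]$ (even if already present); it is a disjoint union of cycles $C_1,\dots,C_d$. A principal coloring $\kappa$ of $\tau$ is a proper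 2-coloring (black/white) of $\hat\tau$. For a cycle $C$ of $\hat\tau$, let $\tau_C$ be the subgraph induced on its vertices; $(\tau_C,\kappa)$ is right-unbalanced if it has more white vertices in the right column than in the left column, left-unbalanced if it has more in the left column, and balanced otherwise. $\alpha(\tau,\kappa)$ is the number of cycles $C$ with $(\tau_C,\kappa)$ right-unbalanced and $\beta(\tau,\kappa)$ the number with $(\tau_C,\kappa)$ left-unbalanced. -}

module Defs where

open import Data.Nat using (ℕ; zero; suc; _+_; _*_; _∸_; _≤ᵇ_; _<ᵇ_)
open import Data.Fin using (Fin; toℕ)
open import Data.Fin.Properties using () renaming (_≟_ to _≟F_)
open import Data.Bool using (Bool; true; false; _∧_; _∨_; not; if_then_else_)
open import Data.List using (List; []; _∷_; allFin; map; _++_; filter; length)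
open import Data.Bool.Properties using () renaming (_≟_ to _≟B_)
open import Data.Product using (_×_; _,_)
open import Relation.Nullary.Decidable using (⌊_⌋)
open import Relation.Binary.PropositionalEquality using (_≡_)

-- Columns of the diagram.  A vertex is (column , height); heights are
-- 0-indexed, so (L , h) is v_{h+1} and (R , h) is v_{2n-h}.
data Side : Set where
  L R : Side

V : ℕ → Set
V n = Side × Fin n

flipSide : Side → Side
flipSide L = R
flipSide R = L

_==S_ : Side → Side → Bool
L ==S L = true
R ==S R = true
_ ==S _ = false

_==V_ : ∀ {n} → V n → V n → Bool
(s , h) ==V (s' , h') = (s ==S s') ∧ ⌊ h ≟F h' ⌋

isL : ∀ {n} → V n → Bool
isL (L , _) = true
isL (R , _) = false

isR : ∀ {n} → V n → Bool
isR v = not (isL v)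

-- the horizontal edge v_i — v_{2n+1-i} added in τ̂
across : ∀ {n} → V n → V n
across (s , h) = (flipSide s , h)

-- code of a vertex: the index k-1 of v_k
code : ∀ {n} → V n → ℕ
code {n} (L , h) = toℕ h
code {n} (R , h) = (n + n) ∸ suc (toℕ h)

vertices : (n : ℕ) → List (V n)
vertices n = map (λ h → (L , h)) (allFin n) ++ map (λ h → (R , h)) (allFin n)

-- A Kauffman diagram (perfect matching) is represented by its partner map.
Diagram : ℕ → Set
Diagram n = V n → V n

idD : ∀ {n} → Diagram n
idD = across

-- the diagram of τ · t_i, where the right column of τ at heights i , i+1
-- (0-indexed heights i and j = i+1) is glued to the left column of t_i;
-- closed loops are removed (ξ = 1).
mulT : ∀ {n} → Diagram n → (i j : Fin n) → Diagram n
mulT m i j x =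
  if x ==V (R , i) then (R , j)
  else if x ==V (R , j) then (R , i)
  else if m x ==V (R , i) then m (R , j)
  else if m x ==V (R , j) then m (R , i)
  else m x

-- 𝓑_n: the monoid generated by t_1 … t_{n-1}, as diagrams:
-- every element is a word id · t_{i_1} · … · t_{i_k}.
data InB (n : ℕ) : Diagram n → Set where
  unit : InB n idD
  step : ∀ {m} → InB n m → (i j : Fin n) → toℕ j ≡ suc (toℕ i) →
         InB n (mulT m i j)

-- Colourings: true = white, false = black.
Coloring : ℕ → Set
Coloring n = V n → Bool

-- proper 2-colouring of τ̂ (edges x — τ x and the added edges x — across x)
Principal : ∀ {n} → Diagram n → Coloring n → Set
Principal {n} m κ =
  ((x : V n) → not (κ x) ≡ κ (m x)) × ((x : V n) → not (κ x) ≡ κ (across x))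

reach : ∀ {n} → Diagram n → ℕ → V n → V n → Bool
reach m zero x y = x ==V y
reach m (suc k) x y = reach m k x y ∨ reach m k (m x) y ∨ reach m k (across x) y

-- x and y lie on the same cycle of τ̂ (a walk exists iff one of length < 2n exists)
conn : ∀ {n} → Diagram n → V n → V n → Bool
conn {n} m x y = reach m (n + n) x y

countB : ∀ {A : Set} → (A → Bool) → List A → ℕ
countB p xs = length (filter (λ a → p a ≟B true) xs)

whiteL whiteR : ∀ {n} → Diagram n → Coloring n → V n → ℕ
whiteL {n} m κ x = countB (λ y → conn m x y ∧ isL y ∧ κ y) (vertices n)
whiteR {n} m κ x = countB (λ y → conn m x y ∧ isR y ∧ κ y) (vertices n)

allB : ∀ {A : Set} → (A → Bool) → List A → Bool
allB p [] = true
allB p (a ∷ as) = p a ∧ allB p as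

isRep : ∀ {n} → Diagram n → V n → Bool
isRep {n} m x = allB (λ y → not (conn m y x) ∨ (code x ≤ᵇ code y)) (vertices n)

-- α: number of right-unbalanced cycles; β: number of left-unbalanced cycles
α β : ∀ {n} → Diagram n → Coloring n → ℕ
α {n} m κ = countB (λ x → isRep m x ∧ (whiteL m κ x <ᵇ whiteR m κ x)) (vertices n)
β {n} m κ = countB (λ x → isRep m x ∧ (whiteR m κ x <ᵇ whiteL m κ x)) (vertices n)

whiteLeft : ∀ {n} → Coloring n → ℕ
whiteLeft {n} κ = countB (λ y → isL y ∧ κ y) (vertices n)

-- Colours alternate along every cycle of τ̂ and the two ends of each added rung v_i — v_{2n+1-i}
-- get opposite colours, so a cycle meeting h heights carries exactly h white vertices.  For a
-- noncrossing diagram its white counts in the two columns differ by at most one: an innermost chord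
-- is either a through strand, which is a cycle on its own, or a cup, and contracting a cup together
-- with the rungs at its ends removes one white vertex from each column of its cycle and keeps the
-- diagram noncrossing.  Hence a cycle is unbalanced exactly when it meets an odd number of heights,
-- so α + β does not depend on κ, and summing the column counts over the cycles gives
-- β + (n − j) = α + j.
module Submission where

open import Defs
open import Data.Bool using (Bool; true; false; _∧_; _∨_; not; T; if_then_else_)
open import Data.Bool.Properties using (not-involutive; ∧-comm; ∧-zeroʳ; ∧-identityʳ; ∨-zeroʳ)
open import Data.Empty using (⊥-elim)
open import Data.Fin using (Fin; toℕ) renaming (zero to fzero; suc to fsuc)
open import Data.Fin.Properties using (suc-injective; toℕ<n; toℕ-injective) renaming (_≟_ to _≟F_)
open import Data.List using (List; []; _∷_; _++_; map; allFin; tabulate)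
open import Data.List.Membership.Propositional using (_∈_; find; lose)
open import Data.List.Membership.Propositional.Properties using (∈-allFin; ∈-map⁺; ∈-++⁺ˡ; ∈-++⁺ʳ)
open import Data.List.Relation.Unary.Any using (here; there; any?)
open import Data.Nat using (ℕ; zero; suc; _+_; _*_; _≤_; _<_; z≤n; s≤s; ∣_-_∣; _<ᵇ_; _/_; _%_)
open import Data.Nat.DivMod using (m*n%n≡0; [m+kn]%n≡m%n)
open import Data.Nat.Properties
  using ( ≤-refl; ≤-trans; ≤-antisym; ≤-pred; <-trans; <-≤-trans; <-irrefl; <-asym; <-cmp; <⇒≢; ≰⇒>; _≤?_
        ; ≤ᵇ⇒≤; ≤⇒≤ᵇ; m≤m+n; m≤n+m; +-mono-≤; +-mono-<-≤; +-mono-≤-<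
        ; +-identityʳ; +-assoc; +-comm; +-suc; +-cancelˡ-≡; +-cancelʳ-≡; *-zeroʳ; *-identityʳ; *-comm
        ; *-distribˡ-+; *-cancelˡ-≡; +-∸-assoc; ∸-monoʳ-<; ∸-cancelʳ-<; ∸-cancelˡ-≡; ∣m+n-m+o∣≡∣n-o∣ )
open import Data.Product using (_×_; _,_; proj₁; proj₂; Σ-syntax; uncurry)
open import Data.Product.Properties using (≡-dec)
open import Data.Sum using (_⊎_; inj₁; inj₂; [_,_]′)
open import Data.Unit using (tt)
open import Function using (const)
open import Relation.Binary using (Transitive; Trichotomous; tri<; tri≈; tri>; DecidableEquality)
open import Relation.Binary.Construct.Closure.ReflexiveTransitive using (Star; ε; _◅_; _◅◅_; reverse; kleisliStar)
open import Relation.Binary.PropositionalEquality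
  using (_≡_; _≢_; refl; sym; trans; cong; cong₂; subst; subst₂; module ≡-Reasoning)
open import Relation.Nullary using (¬_; Dec; yes; no; _×-dec_; _⊎-dec_; does)
open import Relation.Nullary.Decidable using (map′; ⌊_⌋; T?)
import Data.Nat.Properties as ℕₚ
open import Algebra.Properties.CommutativeSemigroup ℕₚ.+-commutativeSemigroup using (interchange)

T-∧⁺ : ∀ {a b} → T a → T b → T (a ∧ b)
T-∧⁺ {true} _ tb = tb

T-∧⁻ˡ : ∀ {a b} → T (a ∧ b) → T a
T-∧⁻ˡ {true} _ = tt

T-∧⁻ʳ : ∀ {a b} → T (a ∧ b) → T b
T-∧⁻ʳ {true} tb = tb

T-∨⁺ˡ : ∀ {a b} → T a → T (a ∨ b)
T-∨⁺ˡ {true} _ = tt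

T-∨⁺ʳ : ∀ {a b} → T b → T (a ∨ b)
T-∨⁺ʳ {true} _ = tt
T-∨⁺ʳ {false} tb = tb

T-∨⁻ : ∀ {a b} → T (a ∨ b) → T a ⊎ T b
T-∨⁻ {true} _ = inj₁ tt
T-∨⁻ {false} tb = inj₂ tb

T-not⁺ : ∀ {a} → ¬ T a → T (not a)
T-not⁺ {true} ¬ta = ¬ta tt
T-not⁺ {false} _ = tt

T-not⁻ : ∀ {a} → T (not a) → ¬ T a
T-not⁻ {true} ()

T-dec : ∀ a → T a ⊎ ¬ T a
T-dec true = inj₁ tt
T-dec false = inj₂ (λ ())

T⇒≡true : ∀ {a} → T a → a ≡ true
T⇒≡true {true} _ = refl

¬T⇒≡false : ∀ {a} → ¬ T a → a ≡ false
¬T⇒≡false {true} ¬ta = ⊥-elim (¬ta tt)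
¬T⇒≡false {false} _ = refl

T-⇔⇒≡ : ∀ {a b} → (T a → T b) → (T b → T a) → a ≡ b
T-⇔⇒≡ {true} {true} _ _ = refl
T-⇔⇒≡ {true} {false} f _ = ⊥-elim (f tt)
T-⇔⇒≡ {false} {true} _ g = ⊥-elim (g tt)
T-⇔⇒≡ {false} {false} _ _ = refl

𝟙 : Bool → ℕ
𝟙 true = 1
𝟙 false = 0

𝟙-∧ : ∀ a b → 𝟙 (a ∧ b) ≡ 𝟙 a * 𝟙 b
𝟙-∧ true b = sym (+-identityʳ (𝟙 b))
𝟙-∧ false b = refl

𝟙-split : ∀ a b → 𝟙 (a ∧ b) + 𝟙 (a ∧ not b) ≡ 𝟙 a
𝟙-split true true = refl
𝟙-split true false = refl
𝟙-split false b = refl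

𝟙-mono : ∀ {a b} → (T a → T b) → 𝟙 a ≤ 𝟙 b
𝟙-mono {false} _ = z≤n
𝟙-mono {true} {true} _ = ≤-refl
𝟙-mono {true} {false} a⇒b = ⊥-elim (a⇒b tt)

𝟙-< : ∀ {a b} → ¬ T a → T b → 𝟙 a < 𝟙 b
𝟙-< {true} ¬ta _ = ⊥-elim (¬ta tt)
𝟙-< {false} {true} _ _ = s≤s z≤n

module _ {A : Set} where

  ∑ : List A → (A → ℕ) → ℕ
  ∑ [] f = 0
  ∑ (a ∷ as) f = f a + ∑ as f

  syntax ∑ xs (λ x → e) = ∑[ x ∈ xs ] e

  ∑-cong : ∀ xs {f g : A → ℕ} → (∀ a → a ∈ xs → f a ≡ g a) → ∑ xs f ≡ ∑ xs g
  ∑-cong [] _ = refl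
  ∑-cong (a ∷ as) f≗g = cong₂ _+_ (f≗g a (here refl)) (∑-cong as (λ b b∈ → f≗g b (there b∈)))

  ∑-+ : ∀ xs (f g : A → ℕ) → ∑[ a ∈ xs ] (f a + g a) ≡ ∑ xs f + ∑ xs g
  ∑-+ [] f g = refl
  ∑-+ (a ∷ as) f g = trans (cong (f a + g a +_) (∑-+ as f g)) (interchange (f a) (g a) (∑ as f) (∑ as g))

  ∑-*ˡ : ∀ c xs (f : A → ℕ) → c * ∑ xs f ≡ ∑[ a ∈ xs ] (c * f a)
  ∑-*ˡ c [] f = *-zeroʳ c
  ∑-*ˡ c (a ∷ as) f = trans (*-distribˡ-+ c (f a) (∑ as f)) (cong (c * f a +_) (∑-*ˡ c as f))

  ∑-++ : ∀ xs ys (f : A → ℕ) → ∑ (xs ++ ys) f ≡ ∑ xs f + ∑ ys f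
  ∑-++ [] ys f = refl
  ∑-++ (a ∷ as) ys f = trans (cong (f a +_) (∑-++ as ys f)) (sym (+-assoc (f a) _ _))

  ∑-mono : ∀ xs {f g : A → ℕ} → (∀ a → f a ≤ g a) → ∑ xs f ≤ ∑ xs g
  ∑-mono [] _ = z≤n
  ∑-mono (a ∷ as) f≤g = +-mono-≤ (f≤g a) (∑-mono as f≤g)

  ∑-mono-< : ∀ xs {f g : A → ℕ} → (∀ a → f a ≤ g a) → ∀ {b} → b ∈ xs → f b < g b → ∑ xs f < ∑ xs g
  ∑-mono-< (a ∷ as) f≤g (here refl) fb<gb = +-mono-<-≤ fb<gb (∑-mono as f≤g)
  ∑-mono-< (a ∷ as) f≤g (there b∈) fb<gb = +-mono-≤-< (f≤g a) (∑-mono-< as f≤g b∈ fb<gb)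

  term≤∑ : ∀ xs (f : A → ℕ) {b} → b ∈ xs → f b ≤ ∑ xs f
  term≤∑ (a ∷ as) f (here refl) = m≤m+n (f a) _
  term≤∑ (a ∷ as) f (there b∈) = ≤-trans (term≤∑ as f b∈) (m≤n+m _ (f a))

  ∑-zero : ∀ xs {f : A → ℕ} → (∀ a → a ∈ xs → f a ≡ 0) → ∑ xs f ≡ 0
  ∑-zero [] _ = refl
  ∑-zero (a ∷ as) f≡0 = cong₂ _+_ (f≡0 a (here refl)) (∑-zero as (λ b b∈ → f≡0 b (there b∈)))

  ∑-countB : ∀ (p : A → Bool) xs → countB p xs ≡ ∑[ a ∈ xs ] 𝟙 (p a)
  ∑-countB p [] = refl
  ∑-countB p (a ∷ as) with p a
  ... | true = cong suc (∑-countB p as)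
  ... | false = ∑-countB p as

∑-map : ∀ {A B : Set} (g : A → B) xs (f : B → ℕ) → ∑ (map g xs) f ≡ ∑[ a ∈ xs ] f (g a)
∑-map g [] f = refl
∑-map g (a ∷ as) f = cong (f (g a) +_) (∑-map g as f)

∑-comm : ∀ {A B : Set} xs ys (F : A → B → ℕ) → ∑[ a ∈ xs ] ∑[ b ∈ ys ] F a b ≡ ∑[ b ∈ ys ] ∑[ a ∈ xs ] F a b
∑-comm [] ys F = sym (∑-zero ys (λ _ _ → refl))
∑-comm (a ∷ as) ys F =
  trans (cong (∑ ys (F a) +_) (∑-comm as ys F)) (sym (∑-+ ys (F a) (λ b → ∑[ a ∈ as ] F a b)))

∑-tabulate : ∀ {A : Set} {n} (g : Fin n → A) (f : A → ℕ) → ∑ (tabulate g) f ≡ ∑[ k ∈ allFin n ] f (g k)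
∑-tabulate {n = zero} g f = refl
∑-tabulate {n = suc n} g f =
  cong (f (g fzero) +_) (trans (∑-tabulate (λ k → g (fsuc k)) f) (sym (∑-tabulate fsuc (λ k → f (g k)))))

∑-allFin-suc : ∀ {n} (f : Fin (suc n) → ℕ) → ∑ (allFin (suc n)) f ≡ f fzero + ∑[ k ∈ allFin n ] f (fsuc k)
∑-allFin-suc f = cong (f fzero +_) (∑-tabulate fsuc f)

∑-allFin-point : ∀ {n} (f : Fin n → ℕ) i → (∀ k → k ≢ i → f k ≡ 0) → ∑ (allFin n) f ≡ f i
∑-allFin-point {suc n} f fzero f≡0 = begin
  ∑ (allFin (suc n)) f                   ≡⟨ ∑-allFin-suc f ⟩
  f fzero + ∑[ k ∈ allFin n ] f (fsuc k) ≡⟨ cong (f fzero +_) (∑-zero (allFin n) (λ k _ → f≡0 (fsuc k) (λ ()))) ⟩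
  f fzero + 0                            ≡⟨ +-identityʳ (f fzero) ⟩
  f fzero                                ∎
  where open ≡-Reasoning
∑-allFin-point {suc n} f (fsuc i) f≡0 = begin
  ∑ (allFin (suc n)) f                   ≡⟨ ∑-allFin-suc f ⟩
  f fzero + ∑[ k ∈ allFin n ] f (fsuc k) ≡⟨ cong₂ _+_ (f≡0 fzero (λ ()))
                                              (∑-allFin-point (λ k → f (fsuc k)) i
                                                (λ k k≢i → f≡0 (fsuc k) (λ e → k≢i (suc-injective e)))) ⟩
  f (fsuc i)                             ∎
  where open ≡-Reasoning

∑-allFin-pair : ∀ {n} (f : Fin n → ℕ) {i j} → i ≢ j → (∀ k → k ≢ i → k ≢ j → f k ≡ 0) → ∑ (allFin n) f ≡ f i + f j
∑-allFin-pair {suc n} f {fzero} {fzero} i≢j _ = ⊥-elim (i≢j refl)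
∑-allFin-pair {suc n} f {fzero} {fsuc j} _ f≡0 = trans (∑-allFin-suc f)
  (cong (f fzero +_) (∑-allFin-point (λ k → f (fsuc k)) j (λ k k≢j → f≡0 (fsuc k) (λ ()) (λ e → k≢j (suc-injective e)))))
∑-allFin-pair {suc n} f {fsuc i} {fzero} _ f≡0 = trans (∑-allFin-suc f) (trans
  (cong (f fzero +_) (∑-allFin-point (λ k → f (fsuc k)) i (λ k k≢i → f≡0 (fsuc k) (λ e → k≢i (suc-injective e)) (λ ()))))
  (+-comm (f fzero) (f (fsuc i))))
∑-allFin-pair {suc n} f {fsuc i} {fsuc j} i≢j f≡0 = trans (∑-allFin-suc f) (cong₂ _+_ (f≡0 fzero (λ ()) (λ ()))
  (∑-allFin-pair (λ k → f (fsuc k)) (λ e → i≢j (cong fsuc e))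
    (λ k k≢i k≢j → f≡0 (fsuc k) (λ e → k≢i (suc-injective e)) (λ e → k≢j (suc-injective e)))))

∑-allFin-const : ∀ n c → ∑[ k ∈ allFin n ] c ≡ n * c
∑-allFin-const zero c = refl
∑-allFin-const (suc n) c = trans (∑-allFin-suc {n} (λ _ → c)) (cong (c +_) (∑-allFin-const n c))

-- Betweenness for a strict total order

module Betweenness {A : Set} (_<_ : A → A → Set) (<-trans : Transitive _<_) (<-cmp : Trichotomous _≡_ _<_) where

  private
    irreflexive : ∀ {x} → ¬ x < x
    irreflexive {x} x<x with <-cmp x x
    ... | tri< _ _ x≮x = x≮x x<x
    ... | tri≈ x≮x _ _ = x≮x x<x
    ... | tri> x≮x _ _ = x≮x x<x

    asymmetric : ∀ {x y} → x < y → ¬ y < x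
    asymmetric x<y y<x = irreflexive (<-trans x<y y<x)

  data Between (z a b : A) : Set where
    ascending : a < z → z < b → Between z a b
    descending : b < z → z < a → Between z a b

  private
    _<?_ : ∀ x y → Dec (x < y)
    x <? y with <-cmp x y
    ... | tri< x<y _ _ = yes x<y
    ... | tri≈ x≮y _ _ = no x≮y
    ... | tri> x≮y _ _ = no x≮y

  Between? : ∀ z a b → Dec (Between z a b)
  Between? z a b = map′ [ uncurry ascending , uncurry descending ]′ split
    ((a <? z ×-dec z <? b) ⊎-dec (b <? z ×-dec z <? a))
    where
    split : Between z a b → (a < z × z < b) ⊎ (b < z × z < a)
    split (ascending a<z z<b) = inj₁ (a<z , z<b)
    split (descending b<z z<a) = inj₂ (b<z , z<a)

  Between-sym : ∀ {z a b} → Between z a b → Between z b a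
  Between-sym (ascending a<z z<b) = descending a<z z<b
  Between-sym (descending b<z z<a) = ascending b<z z<a

  ¬Between-left : ∀ {a b} → ¬ Between a a b
  ¬Between-left (ascending a<a _) = irreflexive a<a
  ¬Between-left (descending _ a<a) = irreflexive a<a

  ¬Between-right : ∀ {a b} → ¬ Between b a b
  ¬Between-right (ascending _ b<b) = irreflexive b<b
  ¬Between-right (descending b<b _) = irreflexive b<b

  Between-oriented : ∀ {z c d} → c < d → Between z c d → c < z × z < d
  Between-oriented c<d (ascending c<z z<d) = c<z , z<d
  Between-oriented c<d (descending d<z z<c) = ⊥-elim (asymmetric c<d (<-trans d<z z<c))

  Between-same-side : ∀ {u u' c d} → c ≢ u' → d ≢ u' → ¬ Between c u u' → ¬ Between d u u' →
    Between u c d → Between u' c d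
  Between-same-side {u} {u'} {c} {d} c≢u' d≢u' c∉ d∉ (ascending c<u u<d) with <-cmp c u' | <-cmp u' d
  ... | tri≈ _ c≡u' _ | _ = ⊥-elim (c≢u' c≡u')
  ... | tri> _ _ u'<c | _ = ⊥-elim (c∉ (descending u'<c c<u))
  ... | tri< _ _ _ | tri≈ _ u'≡d _ = ⊥-elim (d≢u' (sym u'≡d))
  ... | tri< _ _ _ | tri> _ _ d<u' = ⊥-elim (d∉ (ascending u<d d<u'))
  ... | tri< c<u' _ _ | tri< u'<d _ _ = ascending c<u' u'<d
  Between-same-side c≢u' d≢u' c∉ d∉ (descending d<u u<c) =
    Between-sym (Between-same-side d≢u' c≢u' d∉ c∉ (ascending d<u u<c))

  -- Going from z to w crosses a exactly when it crosses b, so it cannot leave the interval (a, b).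
  Between-transfer : ∀ {a b z w} → w ≢ a → w ≢ b →
    (Between a z w → Between b z w) → (Between b z w → Between a z w) → Between z a b → Between w a b
  Between-transfer {a} {b} {z} {w} w≢a w≢b a⇒b b⇒a (ascending a<z z<b) with <-cmp a w | <-cmp w b
  ... | tri≈ _ a≡w _ | _ = ⊥-elim (w≢a (sym a≡w))
  ... | _ | tri≈ _ w≡b _ = ⊥-elim (w≢b w≡b)
  ... | tri< a<w _ _ | tri< w<b _ _ = ascending a<w w<b
  ... | tri> _ _ w<a | _ with Between-oriented (<-trans w<a a<z) (Between-sym (a⇒b (descending w<a a<z)))
  ...   | _ , b<z = ⊥-elim (asymmetric z<b b<z)
  Between-transfer {a} {b} {z} {w} w≢a w≢b a⇒b b⇒a (ascending a<z z<b) | tri< _ _ _ | tri> _ _ b<w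
    with Between-oriented (<-trans z<b b<w) (b⇒a (ascending z<b b<w))
  ... | z<a , _ = ⊥-elim (asymmetric a<z z<a)
  Between-transfer w≢a w≢b a⇒b b⇒a (descending b<z z<a) =
    Between-sym (Between-transfer w≢b w≢a b⇒a a⇒b (ascending b<z z<a))

  Between-convex : ∀ {w z z' c d} → c < z × z < d → c < z' × z' < d → Between w z z' → c < w × w < d
  Between-convex (c<z , z<d) (c<z' , z'<d) (ascending z<w w<z') = <-trans c<z z<w , <-trans w<z' z'<d
  Between-convex (c<z , z<d) (c<z' , z'<d) (descending z'<w w<z) = <-trans c<z' z'<w , <-trans w<z z<d

  Between-interval : ∀ {w z z' c d} → c ≢ d → Between w z z' → Between z c d → Between z' c d → Between w c d
  Between-interval {c = c} {d} c≢d w∈ z∈ z'∈ with <-cmp c d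
  ... | tri< c<d _ _ = uncurry ascending (Between-convex (Between-oriented c<d z∈) (Between-oriented c<d z'∈) w∈)
  ... | tri≈ _ c≡d _ = ⊥-elim (c≢d c≡d)
  ... | tri> _ _ d<c = Between-sym (uncurry ascending
    (Between-convex (Between-oriented d<c (Between-sym z∈)) (Between-oriented d<c (Between-sym z'∈)) w∈))

_≟S_ : DecidableEquality Side
L ≟S L = yes refl
L ≟S R = no (λ ())
R ≟S L = no (λ ())
R ≟S R = yes refl

_≟V_ : ∀ {n} → DecidableEquality (V n)
_≟V_ = ≡-dec _≟S_ _≟F_

==V-sound : ∀ {n} {x y : V n} → T (x ==V y) → x ≡ y
==V-sound {x = L , h} {L , h'} t with h ≟F h'
... | yes refl = refl
==V-sound {x = R , h} {R , h'} t with h ≟F h'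
... | yes refl = refl

==V-refl : ∀ {n} (x : V n) → (x ==V x) ≡ true
==V-refl (L , h) with h ≟F h
... | yes _ = refl
... | no h≢h = ⊥-elim (h≢h refl)
==V-refl (R , h) with h ≟F h
... | yes _ = refl
... | no h≢h = ⊥-elim (h≢h refl)

==V-≢ : ∀ {n} {x y : V n} → x ≢ y → (x ==V y) ≡ false
==V-≢ {x = x} {y} x≢y with x ==V y in eq
... | true = ⊥-elim (x≢y (==V-sound (subst T (sym eq) _)))
... | false = refl

T-==V-refl : ∀ {n} (x : V n) → T (x ==V x)
T-==V-refl x = subst T (sym (==V-refl x)) tt

height : ∀ {n} → V n → Fin n
height = proj₂

flipSide-involutive : ∀ s → flipSide (flipSide s) ≡ s
flipSide-involutive L = refl
flipSide-involutive R = refl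

flipSide-≢ : ∀ s → flipSide s ≢ s
flipSide-≢ L ()
flipSide-≢ R ()

across-involutive : ∀ {n} (x : V n) → across (across x) ≡ x
across-involutive (s , h) = cong (_, h) (flipSide-involutive s)

across-≢ : ∀ {n} (x : V n) → across x ≢ x
across-≢ (L , h) ()
across-≢ (R , h) ()

vertex-at : ∀ {n} s (h : Fin n) {z} → height z ≡ h → z ≡ (s , h) ⊎ z ≡ (flipSide s , h)
vertex-at L h {L , .h} refl = inj₁ refl
vertex-at L h {R , .h} refl = inj₂ refl
vertex-at R h {L , .h} refl = inj₂ refl
vertex-at R h {R , .h} refl = inj₁ refl

code-L<R : ∀ {n} (h h' : Fin n) → code (L , h) < code (R , h')
code-L<R {n} h h' = ≤-trans (toℕ<n h) (subst (n ≤_) (sym (+-∸-assoc n (toℕ<n h'))) (m≤m+n n _))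

code-R<R : ∀ {n} {h h' : Fin n} → toℕ h' < toℕ h → code (R , h) < code (R , h')
code-R<R {n} {h} h'<h = ∸-monoʳ-< (s≤s h'<h) (≤-trans (toℕ<n h) (m≤m+n n n))

code-R<R⁻ : ∀ {n} {h h' : Fin n} → code (R , h) < code (R , h') → toℕ h' < toℕ h
code-R<R⁻ {n} c< = ≤-pred (∸-cancelʳ-< {o = n + n} c<)

code-injective : ∀ {n} {x y : V n} → code x ≡ code y → x ≡ y
code-injective {x = L , h} {L , h'} eq = cong (L ,_) (toℕ-injective eq)
code-injective {n} {R , h} {R , h'} eq =
  cong (R ,_) (toℕ-injective (ℕₚ.suc-injective (∸-cancelˡ-≡ (bound h) (bound h') eq)))
  where
  bound : (k : Fin n) → suc (toℕ k) ≤ n + n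
  bound k = ≤-trans (toℕ<n k) (m≤m+n n n)
code-injective {x = L , h} {R , h'} eq = ⊥-elim (<⇒≢ (code-L<R h h') eq)
code-injective {x = R , h} {L , h'} eq = ⊥-elim (<⇒≢ (code-L<R h' h) (sym eq))

_≺_ : ∀ {n} → V n → V n → Set
x ≺ y = code x < code y

≺-cmp : ∀ {n} → Trichotomous {A = V n} _≡_ _≺_
≺-cmp x y with <-cmp (code x) (code y)
... | tri< x≺y x≉y x⊁y = tri< x≺y (λ x≡y → x≉y (cong code x≡y)) x⊁y
... | tri≈ x⊀y x≈y x⊁y = tri≈ x⊀y (code-injective x≈y) x⊁y
... | tri> x⊀y x≉y x≻y = tri> x⊀y (λ x≡y → x≉y (cong code x≡y)) x≻y

module _ {n : ℕ} where
  open Betweenness {V n} _≺_ <-trans ≺-cmp public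

∈-vertices : ∀ {n} (x : V n) → x ∈ vertices n
∈-vertices {n} (L , h) = ∈-++⁺ˡ (∈-map⁺ (L ,_) (∈-allFin h))
∈-vertices {n} (R , h) = ∈-++⁺ʳ (map (L ,_) (allFin n)) (∈-map⁺ (R ,_) (∈-allFin h))

∑-vertices : ∀ {n} (f : V n → ℕ) → ∑ (vertices n) f ≡ ∑[ h ∈ allFin n ] f (L , h) + ∑[ h ∈ allFin n ] f (R , h)
∑-vertices {n} f = trans (∑-++ (map (L ,_) (allFin n)) _ f) (cong₂ _+_ (∑-map (L ,_) (allFin n) f) (∑-map (R ,_) (allFin n) f))

∑-𝟙≤vertices : ∀ {n} (p : V n → Bool) → ∑[ w ∈ vertices n ] 𝟙 (p w) ≤ n + n
∑-𝟙≤vertices {n} p = subst (∑[ w ∈ vertices n ] 𝟙 (p w) ≤_) all-ones (∑-mono (vertices n) (λ w → 𝟙≤1 (p w)))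
  where
  𝟙≤1 : ∀ b → 𝟙 b ≤ 1
  𝟙≤1 true = ≤-refl
  𝟙≤1 false = z≤n
  ones : ∑[ k ∈ allFin n ] 1 ≡ n
  ones = trans (∑-allFin-const n 1) (*-identityʳ n)
  all-ones : ∑[ w ∈ vertices n ] 1 ≡ n + n
  all-ones = trans (∑-vertices {n} (λ _ → 1)) (cong₂ _+_ ones ones)

∑-side-off : ∀ {n} (f : V n → ℕ) s {z} → s ≢ proj₁ z → (∀ w → w ≢ z → f w ≡ 0) → ∑[ k ∈ allFin n ] f (s , k) ≡ 0
∑-side-off {n} f s s≢ f≡0 = ∑-zero (allFin n) (λ k _ → f≡0 (s , k) (λ e → s≢ (cong proj₁ e)))

∑-side-point : ∀ {n} (f : V n → ℕ) s h → (∀ w → w ≢ (s , h) → f w ≡ 0) → ∑[ k ∈ allFin n ] f (s , k) ≡ f (s , h)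
∑-side-point f s h f≡0 = ∑-allFin-point (λ k → f (s , k)) h (λ k k≢h → f≡0 (s , k) (λ e → k≢h (cong proj₂ e)))

∑-vertices-point : ∀ {n} (f : V n → ℕ) z → (∀ w → w ≢ z → f w ≡ 0) → ∑ (vertices n) f ≡ f z
∑-vertices-point {n} f (L , h) f≡0 =
  trans (∑-vertices f) (trans (cong₂ _+_ (∑-side-point f L h f≡0) (∑-side-off f R (λ ()) f≡0)) (+-identityʳ _))
∑-vertices-point {n} f (R , h) f≡0 =
  trans (∑-vertices f) (cong₂ _+_ (∑-side-off f L (λ ()) f≡0) (∑-side-point f R h f≡0))

side-cases : ∀ s s' → s' ≡ s ⊎ s' ≡ flipSide s
side-cases L L = inj₁ refl
side-cases L R = inj₂ refl
side-cases R L = inj₂ refl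
side-cases R R = inj₁ refl

-- Noncrossing matchings

-- Matchings are considered on the vertices at the heights selected by A only.
active : ∀ {n} → (Fin n → Bool) → V n → Set
active A x = T (A (height x))

data Step {n} (A : Fin n → Bool) (m : V n → V n) (x : V n) : V n → Set where
  chord : active A x → Step A m x (m x)
  rung : active A x → Step A m x (across x)

Connected : ∀ {n} → (Fin n → Bool) → (V n → V n) → V n → V n → Set
Connected A m = Star (Step A m)

record IsNoncrossingMatching {n} (A : Fin n → Bool) (m : V n → V n) : Set where
  field
    preserves : ∀ x → active A x → active A (m x)
    involutive : ∀ x → active A x → m (m x) ≡ x
    no-fixpoint : ∀ x → active A x → m x ≢ x
    noncrossing : ∀ c z → active A c → active A z → z ≢ c → z ≢ m c → Between z c (m c) → Between (m z) c (m c)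

record IsColoring {n} (A : Fin n → Bool) (m : V n → V n) (κ : V n → Bool) : Set where
  field
    flips-chord : ∀ x → active A x → κ (m x) ≡ not (κ x)
    flips-rung : ∀ x → κ (across x) ≡ not (κ x)

module _ {n} {A : Fin n → Bool} {m : V n → V n} (G : IsNoncrossingMatching A m) where
  open IsNoncrossingMatching G

  Step-target : ∀ {x y} → Step A m x y → active A y
  Step-target {x} (chord a) = preserves x a
  Step-target (rung a) = a

  Step-sym : ∀ {x y} → Step A m x y → Step A m y x
  Step-sym {x} (chord a) = subst (Step A m (m x)) (involutive x a) (chord (preserves x a))
  Step-sym {x} (rung a) = subst (Step A m (across x)) (across-involutive x) (rung a)

  Connected-active : ∀ {x y} → active A x → Connected A m x y → active A y
  Connected-active a ε = a
  Connected-active a (s ◅ p) = Connected-active (Step-target s) p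

  Connected-sym : ∀ {x y} → Connected A m x y → Connected A m y x
  Connected-sym = reverse Step-sym

Connected-same-height : ∀ {n} {A : Fin n → Bool} {m x y} → active A x → height x ≡ height y → Connected A m x y
Connected-same-height {x = s , h} {s' , .h} ax refl with side-cases s s'
... | inj₁ refl = ε
... | inj₂ refl = rung ax ◅ ε

-- The chords (u, m u) and (u', m u') are replaced by (u, u') and (m u, m u'); `mulT m i j` is
-- literally `rewire m (R , i) (R , j)`.
rewire : ∀ {n} → (V n → V n) → V n → V n → V n → V n
rewire m u u' x =
  if x ==V u then u'
  else if x ==V u' then u
  else if m x ==V u then m u'
  else if m x ==V u' then m u
  else m x

module _ {n} (m : V n → V n) (u u' : V n) where

  rewire-u : rewire m u u' u ≡ u'
  rewire-u rewrite ==V-refl u = refl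

  rewire-u' : u' ≢ u → rewire m u u' u' ≡ u
  rewire-u' u'≢u rewrite ==V-≢ u'≢u | ==V-refl u' = refl

  rewire-to-u : ∀ {z} → z ≢ u → z ≢ u' → m z ≡ u → rewire m u u' z ≡ m u'
  rewire-to-u z≢u z≢u' mz≡u rewrite ==V-≢ z≢u | ==V-≢ z≢u' | mz≡u | ==V-refl u = refl

  rewire-to-u' : ∀ {z} → z ≢ u → z ≢ u' → m z ≢ u → m z ≡ u' → rewire m u u' z ≡ m u
  rewire-to-u' z≢u z≢u' mz≢u mz≡u' rewrite ==V-≢ z≢u | ==V-≢ z≢u' | ==V-≢ mz≢u | mz≡u' | ==V-refl u' = refl

  rewire-other : ∀ {z} → z ≢ u → z ≢ u' → m z ≢ u → m z ≢ u' → rewire m u u' z ≡ m z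
  rewire-other z≢u z≢u' mz≢u mz≢u' rewrite ==V-≢ z≢u | ==V-≢ z≢u' | ==V-≢ mz≢u | ==V-≢ mz≢u' = refl

  rewire-chord : m u ≡ u' → m u' ≡ u → ∀ z → m (m z) ≡ z → rewire m u u' z ≡ m z
  rewire-chord mu≡u' mu'≡u z mmz≡z with z ≟V u | z ≟V u'
  ... | yes refl | _ = trans rewire-u (sym mu≡u')
  ... | no z≢u | yes refl = trans (rewire-u' z≢u) (sym mu'≡u)
  ... | no z≢u | no z≢u' = rewire-other z≢u z≢u'
    (λ mz≡u → z≢u' (trans (sym mmz≡z) (trans (cong m mz≡u) mu≡u')))
    (λ mz≡u' → z≢u (trans (sym mmz≡z) (trans (cong m mz≡u') mu'≡u)))

chord-to : ∀ {n} {A : Fin n → Bool} {m : V n → V n} {x y} → active A x → m x ≡ y → Connected A m x y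
chord-to {A = A} {m} {x} ax mx≡y = subst (Connected A m x) mx≡y (chord ax ◅ ε)

module Rewiring {n} {A : Fin n → Bool} {m : V n → V n} (G : IsNoncrossingMatching A m) {u u' : V n}
  (u-active : active A u) (u'-active : active A u') (u≢u' : u ≢ u')
  (nothing-between : ∀ z → active A z → ¬ Between z u u') (mu≢u' : m u ≢ u') where

  open IsNoncrossingMatching G

  a b : V n
  a = m u
  b = m u'

  r : V n → V n
  r = rewire m u u'

  a-active : active A a
  a-active = preserves u u-active

  b-active : active A b
  b-active = preserves u' u'-active

  ma≡u : m a ≡ u
  ma≡u = involutive u u-active

  mb≡u' : m b ≡ u'
  mb≡u' = involutive u' u'-active

  u'≢u : u' ≢ u
  u'≢u u'≡u = u≢u' (sym u'≡u)

  a≢u : a ≢ u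
  a≢u = no-fixpoint u u-active

  b≢u : b ≢ u
  b≢u b≡u = mu≢u' (trans (cong m (sym b≡u)) mb≡u')

  b≢u' : b ≢ u'
  b≢u' = no-fixpoint u' u'-active

  a≢b : a ≢ b
  a≢b a≡b = u≢u' (trans (sym ma≡u) (trans (cong m a≡b) mb≡u'))

  Other : V n → Set
  Other z = z ≢ u × z ≢ u' × z ≢ a × z ≢ b

  Other-m : ∀ {z} → active A z → Other z → Other (m z)
  Other-m {z} az (z≢u , z≢u' , z≢a , z≢b) =
    (λ mz≡u → z≢a (trans (sym (involutive z az)) (cong m mz≡u))) ,
    (λ mz≡u' → z≢b (trans (sym (involutive z az)) (cong m mz≡u'))) ,
    (λ mz≡a → z≢u (trans (sym (involutive z az)) (trans (cong m mz≡a) ma≡u))) ,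
    (λ mz≡b → z≢u' (trans (sym (involutive z az)) (trans (cong m mz≡b) mb≡u')))

  data Position : V n → Set where
    at-u : Position u
    at-u' : Position u'
    at-a : Position a
    at-b : Position b
    elsewhere : ∀ {z} → Other z → Position z

  position : ∀ z → Position z
  position z with z ≟V u | z ≟V u' | z ≟V a | z ≟V b
  ... | yes refl | _ | _ | _ = at-u
  ... | no _ | yes refl | _ | _ = at-u'
  ... | no _ | no _ | yes refl | _ = at-a
  ... | no _ | no _ | no _ | yes refl = at-b
  ... | no z≢u | no z≢u' | no z≢a | no z≢b = elsewhere (z≢u , z≢u' , z≢a , z≢b)

  r-u : r u ≡ u'
  r-u = rewire-u m u u'

  r-u' : r u' ≡ u
  r-u' = rewire-u' m u u' u'≢u

  r-a : r a ≡ b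
  r-a = rewire-to-u m u u' a≢u (λ a≡u' → mu≢u' a≡u') ma≡u

  r-b : r b ≡ a
  r-b = rewire-to-u' m u u' b≢u b≢u' (λ mb≡u → u≢u' (sym (trans (sym mb≡u') mb≡u))) mb≡u'

  r-other : ∀ {z} → active A z → Other z → r z ≡ m z
  r-other az o@(z≢u , z≢u' , _) with Other-m az o
  ... | mz≢u , mz≢u' , _ = rewire-other m u u' z≢u z≢u' mz≢u mz≢u'

  r-preserves : ∀ z → active A z → active A (r z)
  r-preserves z az with position z
  ... | at-u = subst (active A) (sym r-u) u'-active
  ... | at-u' = subst (active A) (sym r-u') u-active
  ... | at-a = subst (active A) (sym r-a) b-active
  ... | at-b = subst (active A) (sym r-b) a-active
  ... | elsewhere o = subst (active A) (sym (r-other az o)) (preserves z az)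

  r-involutive : ∀ z → active A z → r (r z) ≡ z
  r-involutive z az with position z
  ... | at-u = trans (cong r r-u) r-u'
  ... | at-u' = trans (cong r r-u') r-u
  ... | at-a = trans (cong r r-a) r-b
  ... | at-b = trans (cong r r-b) r-a
  ... | elsewhere o =
    trans (cong r (r-other az o)) (trans (r-other (preserves z az) (Other-m az o)) (involutive z az))

  r-no-fixpoint : ∀ z → active A z → r z ≢ z
  r-no-fixpoint z az with position z
  ... | at-u = λ u'≡u → u'≢u (trans (sym r-u) u'≡u)
  ... | at-u' = λ u≡u' → u≢u' (trans (sym r-u') u≡u')
  ... | at-a = λ b≡a → a≢b (sym (trans (sym r-a) b≡a))
  ... | at-b = λ a≡b → a≢b (trans (sym r-b) a≡b)
  ... | elsewhere o = λ mz≡z → no-fixpoint z az (trans (sym (r-other az o)) mz≡z)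

  -- Since no active vertex separates u from u', every chord has u and u' on the same side.
  u∈⇒u'∈ : ∀ {c d} → active A c → active A d → c ≢ u' → d ≢ u' → Between u c d → Between u' c d
  u∈⇒u'∈ ac ad c≢u' d≢u' = Between-same-side c≢u' d≢u' (nothing-between _ ac) (nothing-between _ ad)

  u'∈⇒u∈ : ∀ {c d} → active A c → active A d → c ≢ u → d ≢ u → Between u' c d → Between u c d
  u'∈⇒u∈ ac ad c≢u d≢u = Between-same-side c≢u d≢u (λ c∈ → nothing-between _ ac (Between-sym c∈))
                                                  (λ d∈ → nothing-between _ ad (Between-sym d∈))

  a∈⇒b∈ : ∀ {c} → active A c → Other c → Between a c (m c) → Between b c (m c)
  a∈⇒b∈ {c} ac o@(c≢u , c≢u' , c≢a , c≢b) a∈ with Other-m ac o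
  ... | mc≢u , mc≢u' , mc≢a , mc≢b =
    noncrossing c u' ac u'-active (λ u'≡c → c≢u' (sym u'≡c)) (λ u'≡mc → mc≢u' (sym u'≡mc))
      (u∈⇒u'∈ ac (preserves c ac) c≢u' mc≢u'
        (subst (λ w → Between w c (m c)) ma≡u
          (noncrossing c a ac a-active (λ a≡c → c≢a (sym a≡c)) (λ a≡mc → mc≢a (sym a≡mc)) a∈)))

  b∈⇒a∈ : ∀ {c} → active A c → Other c → Between b c (m c) → Between a c (m c)
  b∈⇒a∈ {c} ac o@(c≢u , c≢u' , c≢a , c≢b) b∈ with Other-m ac o
  ... | mc≢u , mc≢u' , mc≢a , mc≢b =
    noncrossing c u ac u-active (λ u≡c → c≢u (sym u≡c)) (λ u≡mc → mc≢u (sym u≡mc))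
      (u'∈⇒u∈ ac (preserves c ac) c≢u mc≢u
        (subst (λ w → Between w c (m c)) mb≡u'
          (noncrossing c b ac b-active (λ b≡c → c≢b (sym b≡c)) (λ b≡mc → mc≢b (sym b≡mc)) b∈)))

  r-noncrossing-ab : ∀ z → active A z → z ≢ a → z ≢ b → Between z a b → Between (r z) a b
  r-noncrossing-ab z az z≢a z≢b z∈ with position z
  ... | at-u = subst (λ w → Between w a b) (sym r-u) (u∈⇒u'∈ a-active b-active mu≢u' b≢u' z∈)
  ... | at-u' = subst (λ w → Between w a b) (sym r-u') (u'∈⇒u∈ a-active b-active a≢u b≢u z∈)
  ... | at-a = ⊥-elim (z≢a refl)
  ... | at-b = ⊥-elim (z≢b refl)
  ... | elsewhere o with Other-m az o
  ...   | _ , _ , mz≢a , mz≢b = subst (λ w → Between w a b) (sym (r-other az o))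
    (Between-transfer mz≢a mz≢b (a∈⇒b∈ az o) (b∈⇒a∈ az o) z∈)

  r-noncrossing-other : ∀ c → active A c → Other c →
    ∀ z → active A z → z ≢ c → z ≢ m c → Between z c (m c) → Between (r z) c (m c)
  r-noncrossing-other c ac o@(c≢u , c≢u' , _) z az z≢c z≢mc z∈ with Other-m ac o | position z
  ... | mc≢u , mc≢u' , _ | at-u =
    subst (λ w → Between w c (m c)) (sym r-u) (u∈⇒u'∈ ac (preserves c ac) c≢u' mc≢u' z∈)
  ... | mc≢u , mc≢u' , _ | at-u' =
    subst (λ w → Between w c (m c)) (sym r-u') (u'∈⇒u∈ ac (preserves c ac) c≢u mc≢u z∈)
  ... | _ | at-a = subst (λ w → Between w c (m c)) (sym r-a) (a∈⇒b∈ ac o z∈)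
  ... | _ | at-b = subst (λ w → Between w c (m c)) (sym r-b) (b∈⇒a∈ ac o z∈)
  ... | _ | elsewhere oz =
    subst (λ w → Between w c (m c)) (sym (r-other az oz)) (noncrossing c z ac az z≢c z≢mc z∈)

  r-noncrossing : ∀ c z → active A c → active A z → z ≢ c → z ≢ r c → Between z c (r c) → Between (r z) c (r c)
  r-noncrossing c z ac az z≢c z≢rc z∈ with position c
  ... | at-u = ⊥-elim (nothing-between z az (subst (Between z u) r-u z∈))
  ... | at-u' = ⊥-elim (nothing-between z az (Between-sym (subst (Between z u') r-u' z∈)))
  ... | at-a = subst (Between (r z) a) (sym r-a)
    (r-noncrossing-ab z az z≢c (λ z≡b → z≢rc (trans z≡b (sym r-a))) (subst (Between z a) r-a z∈))
  ... | at-b = subst (Between (r z) b) (sym r-b) (Between-sym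
    (r-noncrossing-ab z az (λ z≡a → z≢rc (trans z≡a (sym r-b))) z≢c (Between-sym (subst (Between z b) r-b z∈))))
  ... | elsewhere o = subst (Between (r z) c) (sym (r-other ac o))
    (r-noncrossing-other c ac o z az z≢c (λ z≡mc → z≢rc (trans z≡mc (sym (r-other ac o))))
      (subst (Between z c) (r-other ac o) z∈))

  isNoncrossingMatching : IsNoncrossingMatching A r
  isNoncrossingMatching = record
    { preserves = r-preserves ; involutive = r-involutive ; no-fixpoint = r-no-fixpoint ; noncrossing = r-noncrossing }

  isColoring : ∀ {κ} → IsColoring A m κ → κ u' ≡ not (κ u) → IsColoring A r κ
  isColoring {κ} K κu'≡ = record { flips-chord = flips ; flips-rung = IsColoring.flips-rung K }
    where
    open IsColoring K using (flips-chord)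
    flips : ∀ z → active A z → κ (r z) ≡ not (κ z)
    flips z az with position z
    ... | at-u = trans (cong κ r-u) κu'≡
    ... | at-u' = trans (cong κ r-u') (trans (sym (not-involutive (κ u))) (cong not (sym κu'≡)))
    ... | at-a = trans (cong κ r-a)
      (trans (flips-chord u' u'-active) (trans (cong not κu'≡) (cong not (sym (flips-chord u u-active)))))
    ... | at-b = trans (cong κ r-b) (trans (flips-chord u u-active)
      (sym (trans (cong not (flips-chord u' u'-active)) (trans (not-involutive (κ u')) κu'≡))))
    ... | elsewhere o = trans (cong κ (r-other az o)) (flips-chord z az)

IsNoncrossingMatching-cong : ∀ {n} {A : Fin n → Bool} {f g : V n → V n} →
  (∀ z → f z ≡ g z) → IsNoncrossingMatching A f → IsNoncrossingMatching A g
IsNoncrossingMatching-cong {A = A} {f} {g} f≗g G = record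
  { preserves = λ x a → subst (active A) (f≗g x) (preserves x a)
  ; involutive = λ x a → trans (sym (trans (cong f (f≗g x)) (f≗g (g x)))) (involutive x a)
  ; no-fixpoint = λ x a gx≡x → no-fixpoint x a (trans (f≗g x) gx≡x)
  ; noncrossing = λ c z ac az → subst (λ w → z ≢ c → z ≢ w → Between z c w → Between (g z) c w) (f≗g c)
      (subst (λ w → z ≢ c → z ≢ f c → Between z c (f c) → Between w c (f c)) (f≗g z) (noncrossing c z ac az))
  }
  where open IsNoncrossingMatching G

across-inside : ∀ {n} {h : Fin n} {z} → (L , h) ≺ z → z ≺ (R , h) → (L , h) ≺ across z × across z ≺ (R , h)
across-inside {h = h} {L , k} h<k _ = code-L<R h k , code-R<R h<k
across-inside {h = h} {R , k} _ k≺h = code-R<R⁻ k≺h , code-L<R k h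

across-noncrossing : ∀ {n} (c z : V n) → Between z c (across c) → Between (across z) c (across c)
across-noncrossing (L , h) z z∈ with Between-oriented (code-L<R h h) z∈
... | h≺z , z≺h with across-inside {z = z} h≺z z≺h
...   | h≺z' , z'≺h = ascending h≺z' z'≺h
across-noncrossing (R , h) z z∈ = Between-sym (across-noncrossing (L , h) z (Between-sym z∈))

identity-isNoncrossingMatching : ∀ {n} → IsNoncrossingMatching {n} (const true) across
identity-isNoncrossingMatching = record
  { preserves = λ _ _ → tt
  ; involutive = λ x _ → across-involutive x
  ; no-fixpoint = λ x _ → across-≢ x
  ; noncrossing = λ c z _ _ _ _ → across-noncrossing c z
  }

adjacent-right : ∀ {n} {i j : Fin n} → toℕ j ≡ suc (toℕ i) → ∀ z → ¬ Between z (R , i) (R , j)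
adjacent-right {i = i} {j} j≡1+i z z∈ with Between-oriented (code-R<R (subst (toℕ i <_) (sym j≡1+i) ≤-refl)) (Between-sym z∈)
adjacent-right {i = i} {j} j≡1+i (L , k) z∈ | j≺z , _ = <-asym j≺z (code-L<R k j)
adjacent-right {i = i} {j} j≡1+i (R , k) z∈ | j≺z , z≺i with code-R<R⁻ j≺z | code-R<R⁻ z≺i
... | k<j | i<k = <-irrefl refl (<-≤-trans i<k (≤-pred (subst (toℕ k <_) j≡1+i k<j)))

InB-isNoncrossingMatching : ∀ {n} {τ : Diagram n} → InB n τ → IsNoncrossingMatching (const true) τ
InB-isNoncrossingMatching unit = identity-isNoncrossingMatching
InB-isNoncrossingMatching (step {τ} τ∈ i j j≡1+i) with τ (R , i) ≟V (R , j)
-- Here t_i closes the chord between (R , i) and (R , j) into a loop, which is removed: τ t_i = τ.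
... | yes τi≡j = IsNoncrossingMatching-cong
  (λ z → sym (rewire-chord τ (R , i) (R , j) τi≡j (trans (cong τ (sym τi≡j)) (involutive (R , i) tt)) z (involutive z tt))) G
  where
  G = InB-isNoncrossingMatching τ∈
  open IsNoncrossingMatching G
... | no τi≢j = Rewiring.isNoncrossingMatching (InB-isNoncrossingMatching τ∈) tt tt i≢j (λ z _ → adjacent-right j≡1+i z) τi≢j
  where
  i≢j : (R , i) ≢ (R , j)
  i≢j i≡j = <-irrefl (cong (λ z → toℕ (height z)) i≡j) (subst (toℕ i <_) (sym j≡1+i) ≤-refl)

-- Innermost chords

𝟙-does-mono : ∀ {P Q : Set} (P? : Dec P) (Q? : Dec Q) → (P → Q) → 𝟙 (does P?) ≤ 𝟙 (does Q?)
𝟙-does-mono (no _) _ _ = z≤n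
𝟙-does-mono (yes p) (yes _) _ = ≤-refl
𝟙-does-mono (yes p) (no ¬q) P⇒Q = ⊥-elim (¬q (P⇒Q p))

𝟙-does-< : ∀ {P Q : Set} (P? : Dec P) (Q? : Dec Q) → ¬ P → Q → 𝟙 (does P?) < 𝟙 (does Q?)
𝟙-does-< (no _) (yes _) _ _ = s≤s z≤n
𝟙-does-< (yes p) _ ¬p _ = ⊥-elim (¬p p)
𝟙-does-< _ (no ¬q) _ q = ⊥-elim (¬q q)

across-ascending : ∀ {n} s {i j : Fin n} {z} → (s , i) ≺ z → z ≺ (s , j) → Between (across z) (flipSide s , i) (flipSide s , j)
across-ascending L {z = L , k} i<k k<j = descending (code-R<R k<j) (code-R<R i<k)
across-ascending L {j = j} {R , k} _ k≺j = ⊥-elim (<-asym k≺j (code-L<R j k))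
across-ascending R {i} {z = L , k} i≺k _ = ⊥-elim (<-asym i≺k (code-L<R k i))
across-ascending R {z = R , k} i≺k k≺j = descending (code-R<R⁻ k≺j) (code-R<R⁻ i≺k)

across-Between : ∀ {n} s {i j : Fin n} {z} → Between z (s , i) (s , j) → Between (across z) (flipSide s , i) (flipSide s , j)
across-Between s (ascending i≺z z≺j) = across-ascending s i≺z z≺j
across-Between s (descending j≺z z≺i) = Between-sym (across-ascending s j≺z z≺i)

module _ {n} {A : Fin n → Bool} {m : V n → V n} (G : IsNoncrossingMatching A m) where
  open IsNoncrossingMatching G

  Innermost : V n → Set
  Innermost p = ∀ z → active A z → ¬ Between z p (m p)

  private
    enclosed? : ∀ c z → Dec (active A z × Between z c (m c))
    enclosed? c z = T? (A (height z)) ×-dec Between? z c (m c)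

    enclosed-count : V n → ℕ
    enclosed-count c = ∑[ z ∈ vertices n ] 𝟙 (does (enclosed? c z))

    enclosed-count-< : ∀ {c z} → active A c → active A z → Between z c (m c) → enclosed-count z < enclosed-count c
    enclosed-count-< {c} {z} ac az z∈ = ∑-mono-< (vertices n)
      (λ w → 𝟙-does-mono (enclosed? z w) (enclosed? c w) (λ where (aw , w∈) → aw , Between-interval c≢mc w∈ z∈ mz∈))
      (∈-vertices z) (𝟙-does-< (enclosed? z z) (enclosed? c z) (λ where (_ , z∈z) → ¬Between-left z∈z) (az , z∈))
      where
      c≢mc : c ≢ m c
      c≢mc c≡mc = no-fixpoint c ac (sym c≡mc)
      mz∈ : Between (m z) c (m c)
      mz∈ = noncrossing c z ac az (λ where refl → ¬Between-left z∈) (λ where refl → ¬Between-right z∈) z∈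

    innermost-below : ∀ k c → active A c → enclosed-count c < k → Σ[ p ∈ V n ] active A p × Innermost p
    innermost-below (suc k) c ac bound with any? (enclosed? c) (vertices n)
    ... | no none = c , ac , λ z az z∈ → none (lose (∈-vertices z) (az , z∈))
    ... | yes some with find some
    ...   | z , _ , az , z∈ = innermost-below k z az (≤-trans (enclosed-count-< ac az z∈) (≤-pred bound))

  innermost : ∀ c → active A c → Σ[ p ∈ V n ] active A p × Innermost p
  innermost c ac = innermost-below (suc (enclosed-count c)) c ac ≤-refl

  data Shape (p : V n) : Set where
    through : m p ≡ across p → Shape p
    cup : ∀ s {i j} → p ≡ (s , i) → m p ≡ (s , j) → i ≢ j →
      (∀ z → active A z → ¬ Between z (flipSide s , i) (flipSide s , j)) → Shape p

  shape : ∀ p → active A p → Innermost p → Shape p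
  shape (s , i) ap inner with m (s , i) in mp≡
  shape (L , i) ap inner | L , j = cup L refl mp≡ (λ i≡j → no-fixpoint _ ap (trans mp≡ (cong (L ,_) (sym i≡j))))
    (λ z az z∈ → inner (across z) az (across-Between R z∈))
  shape (R , i) ap inner | R , j = cup R refl mp≡ (λ i≡j → no-fixpoint _ ap (trans mp≡ (cong (R ,_) (sym i≡j))))
    (λ z az z∈ → inner (across z) az (across-Between L z∈))
  shape (L , i) ap inner | R , j with <-cmp (toℕ i) (toℕ j)
  ... | tri≈ _ i≡j _ = through (trans mp≡ (cong (R ,_) (sym (toℕ-injective i≡j))))
  ... | tri< i<j _ _ = ⊥-elim (inner (L , j) (subst (active A) mp≡ (preserves (L , i) ap))
    (ascending i<j (code-L<R j j)))
  ... | tri> _ _ j<i = ⊥-elim (inner (R , i) ap (ascending (code-L<R i i) (code-R<R j<i)))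
  shape (R , i) ap inner | L , j with <-cmp (toℕ i) (toℕ j)
  ... | tri≈ _ i≡j _ = through (trans mp≡ (cong (L ,_) (sym (toℕ-injective i≡j))))
  ... | tri< i<j _ _ = ⊥-elim (inner (R , j) (subst (active A) mp≡ (preserves (R , i) ap))
    (descending (code-L<R j j) (code-R<R i<j)))
  ... | tri> _ _ j<i = ⊥-elim (inner (L , i) ap (descending j<i (code-L<R i i)))

_∖_ : ∀ {n} → (Fin n → Bool) → (Fin n → Bool) → Fin n → Bool
(A ∖ H) k = A k ∧ not (H k)

activeCount : ∀ {n} → (Fin n → Bool) → ℕ
activeCount {n} A = ∑[ k ∈ allFin n ] 𝟙 (A k)

activeCount-pos : ∀ {n} {A : Fin n → Bool} {v} → active A v → 1 ≤ activeCount A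
activeCount-pos {n} {A} {v} av = subst (λ b → 𝟙 b ≤ activeCount A) (T⇒≡true av)
  (term≤∑ (allFin n) (λ k → 𝟙 (A k)) (∈-allFin (height v)))

activeCount-∖ : ∀ {n} {A H : Fin n → Bool} {i} → T (A i) → T (H i) → activeCount (A ∖ H) < activeCount A
activeCount-∖ {n} {A} {H} {i} Ai Hi = ∑-mono-< (allFin n) (λ k → 𝟙-mono (T-∧⁻ˡ {A k})) (∈-allFin i) drop-i
  where
  drop-i : 𝟙 (A i ∧ not (H i)) < 𝟙 (A i)
  drop-i rewrite T⇒≡true Ai | T⇒≡true Hi = s≤s z≤n

module Restriction {n} {A : Fin n → Bool} (H : Fin n → Bool) where

  ∖⇒active : ∀ x → active (A ∖ H) x → active A x
  ∖⇒active x = T-∧⁻ˡ {A (height x)}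

  ∖⇒∉ : ∀ x → active (A ∖ H) x → ¬ T (H (height x))
  ∖⇒∉ x a = T-not⁻ (T-∧⁻ʳ {A (height x)} a)

  ∉⇒∖ : ∀ x → active A x → ¬ T (H (height x)) → active (A ∖ H) x
  ∉⇒∖ x a ∉ = T-∧⁺ {A (height x)} a (T-not⁺ {H (height x)} ∉)

  ∖-isNoncrossingMatching : ∀ {m} → IsNoncrossingMatching A m →
    (∀ x → active (A ∖ H) x → active (A ∖ H) (m x)) → IsNoncrossingMatching (A ∖ H) m
  ∖-isNoncrossingMatching G preserves′ = record
    { preserves = preserves′
    ; involutive = λ x a → involutive x (∖⇒active x a)
    ; no-fixpoint = λ x a → no-fixpoint x (∖⇒active x a)
    ; noncrossing = λ c z ac az → noncrossing c z (∖⇒active c ac) (∖⇒active z az)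
    }
    where open IsNoncrossingMatching G

  ∖-isColoring : ∀ {m κ} → IsColoring A m κ → IsColoring (A ∖ H) m κ
  ∖-isColoring K = record { flips-chord = λ x a → flips-chord x (∖⇒active x a) ; flips-rung = flips-rung }
    where open IsColoring K

  Connected-∖⇒ : ∀ {m x y} → Connected (A ∖ H) m x y → Connected A m x y
  Connected-∖⇒ ε = ε
  Connected-∖⇒ {x = x} (chord a ◅ p) = chord (∖⇒active x a) ◅ Connected-∖⇒ p
  Connected-∖⇒ {x = x} (rung a ◅ p) = rung (∖⇒active x a) ◅ Connected-∖⇒ p

  module Closed {m : V n → V n} (G : IsNoncrossingMatching A m)
    (closed : ∀ x → active A x → T (H (height x)) → T (H (height (m x)))) where
    open IsNoncrossingMatching G

    ∉-preserved : ∀ x → active A x → ¬ T (H (height x)) → ¬ T (H (height (m x)))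
    ∉-preserved x a x∉ mx∈ = x∉ (subst (λ y → T (H (height y))) (involutive x a) (closed (m x) (preserves x a) mx∈))

    ∖-preserves : ∀ x → active (A ∖ H) x → active (A ∖ H) (m x)
    ∖-preserves x a = ∉⇒∖ (m x) (preserves x (∖⇒active x a)) (∉-preserved x (∖⇒active x a) (∖⇒∉ x a))

    Connected-∈ : ∀ {x y} → Connected A m x y → active A x → T (H (height x)) → T (H (height y))
    Connected-∈ ε _ x∈ = x∈
    Connected-∈ (chord _ ◅ p) a x∈ = Connected-∈ p (preserves _ a) (closed _ a x∈)
    Connected-∈ (rung _ ◅ p) a x∈ = Connected-∈ p a x∈

    Connected⇒∖ : ∀ {x y} → Connected A m x y → active A x → ¬ T (H (height x)) → Connected (A ∖ H) m x y
    Connected⇒∖ ε _ _ = ε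
    Connected⇒∖ {x} (chord _ ◅ p) a x∉ = chord (∉⇒∖ x a x∉) ◅ Connected⇒∖ p (preserves _ a) (∉-preserved _ a x∉)
    Connected⇒∖ {x} (rung _ ◅ p) a x∉ = rung (∉⇒∖ x a x∉) ◅ Connected⇒∖ p a x∉

onSide : ∀ {n} → Side → V n → Bool
onSide L = isL
onSide R = isR

-- With P = conn m x this is whiteL m κ x (for s = L) or whiteR m κ x (for s = R).
whites : ∀ {n} → Side → (V n → Bool) → Coloring n → ℕ
whites {n} s P κ = countB (λ y → P y ∧ onSide s y ∧ κ y) (vertices n)

∑-𝟙-∧false : ∀ {A : Set} xs (p : A → Bool) → ∑[ a ∈ xs ] 𝟙 (p a ∧ false) ≡ 0
∑-𝟙-∧false xs p = ∑-zero xs (λ a _ → cong 𝟙 (∧-zeroʳ (p a)))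

whites-∑ : ∀ {n} s (P : V n → Bool) κ → whites s P κ ≡ ∑[ k ∈ allFin n ] 𝟙 (P (s , k) ∧ κ (s , k))
whites-∑ {n} L P κ = trans (∑-countB _ (vertices n)) (trans (∑-vertices (λ y → 𝟙 (P y ∧ isL y ∧ κ y)))
  (trans (cong (∑[ k ∈ allFin n ] 𝟙 (P (L , k) ∧ κ (L , k)) +_) (∑-𝟙-∧false (allFin n) (λ k → P (R , k)))) (+-identityʳ _)))
whites-∑ {n} R P κ = trans (∑-countB _ (vertices n)) (trans (∑-vertices (λ y → 𝟙 (P y ∧ isR y ∧ κ y)))
  (cong (_+ ∑[ k ∈ allFin n ] 𝟙 (P (R , k) ∧ κ (R , k))) (∑-𝟙-∧false (allFin n) (λ k → P (L , k)))))

∧-swapʳ : ∀ a b c → (a ∧ b) ∧ c ≡ (a ∧ c) ∧ b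
∧-swapʳ true b c = ∧-comm b c
∧-swapʳ false b c = refl

_without_ : ∀ {n} → (V n → Bool) → (Fin n → Bool) → V n → Bool
(P without H) z = P z ∧ not (H (height z))

whites-split : ∀ {n} s (P : V n → Bool) κ (H : Fin n → Bool) →
  whites s P κ ≡ ∑[ k ∈ allFin n ] 𝟙 ((P (s , k) ∧ κ (s , k)) ∧ H k) + whites s (P without H) κ
whites-split {n} s P κ H = begin
  whites s P κ
    ≡⟨ whites-∑ s P κ ⟩
  ∑[ k ∈ allFin n ] 𝟙 (P (s , k) ∧ κ (s , k))
    ≡⟨ ∑-cong (allFin n) (λ k _ → sym (𝟙-split (P (s , k) ∧ κ (s , k)) (H k))) ⟩
  ∑[ k ∈ allFin n ] (𝟙 ((P (s , k) ∧ κ (s , k)) ∧ H k) + 𝟙 ((P (s , k) ∧ κ (s , k)) ∧ not (H k)))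
    ≡⟨ ∑-+ (allFin n) _ _ ⟩
  ∑[ k ∈ allFin n ] 𝟙 ((P (s , k) ∧ κ (s , k)) ∧ H k) + ∑[ k ∈ allFin n ] 𝟙 ((P (s , k) ∧ κ (s , k)) ∧ not (H k))
    ≡⟨ cong (∑[ k ∈ allFin n ] 𝟙 ((P (s , k) ∧ κ (s , k)) ∧ H k) +_)
         (trans (∑-cong (allFin n) (λ k _ → cong 𝟙 (∧-swapʳ (P (s , k)) (κ (s , k)) (not (H k)))))
                (sym (whites-∑ s (P without H) κ))) ⟩
  ∑[ k ∈ allFin n ] 𝟙 ((P (s , k) ∧ κ (s , k)) ∧ H k) + whites s (P without H) κ ∎
  where open ≡-Reasoning

whites-empty : ∀ {n} s (P : V n → Bool) κ → (∀ z → ¬ T (P z)) → whites s P κ ≡ 0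
whites-empty {n} s P κ ∅ = trans (whites-∑ s P κ) (∑-zero (allFin n) (λ k _ → empty k))
  where
  empty : ∀ k → 𝟙 (P (s , k) ∧ κ (s , k)) ≡ 0
  empty k with P (s , k) in eq
  ... | true = ⊥-elim (∅ (s , k) (subst T (sym eq) _))
  ... | false = refl

record IsComponent {n} (A : Fin n → Bool) (m : V n → V n) (v : V n) (P : V n → Bool) : Set where
  field
    connected : ∀ {z} → T (P z) → Connected A m v z
    member : ∀ {z} → Connected A m v z → T (P z)

NearlyBalanced : ∀ {n} → (V n → Bool) → Coloring n → Set
NearlyBalanced P κ = ∣ whites L P κ - whites R P κ ∣ ≤ 1

ComponentsNearlyBalanced : ∀ {n} → (Fin n → Bool) → (V n → V n) → Coloring n → Set
ComponentsNearlyBalanced A m κ = ∀ {v P} → active A v → IsComponent A m v P → NearlyBalanced P κ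

ComponentsNearlyBalancedBelow : ∀ {n} → (Fin n → Bool) → Coloring n → Set
ComponentsNearlyBalancedBelow {n} A κ = ∀ {A' : Fin n → Bool} {m'} → activeCount A' < activeCount A →
  IsNoncrossingMatching A' m' → IsColoring A' m' κ → ComponentsNearlyBalanced A' m' κ

whites-at : ∀ {n} s {P : V n → Bool} {κ} {h} → (∀ z → T (P z) → height z ≡ h) → T (P (s , h)) →
  whites s P κ ≡ 𝟙 (κ (s , h))
whites-at {n} s {P} {κ} {h} P⊆h Ph =
  trans (whites-∑ s P κ) (trans (∑-allFin-point _ h outside) (cong (λ b → 𝟙 (b ∧ κ (s , h))) (T⇒≡true Ph)))
  where
  outside : ∀ k → k ≢ h → 𝟙 (P (s , k) ∧ κ (s , k)) ≡ 0
  outside k k≢h with P (s , k) in eq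
  ... | true = ⊥-elim (k≢h (P⊆h (s , k) (subst T (sym eq) _)))
  ... | false = refl

atPair : ∀ {n} → Fin n → Fin n → Fin n → Bool
atPair i j k = ⌊ k ≟F i ⌋ ∨ ⌊ k ≟F j ⌋

whites-pair : ∀ {n} s {P : V n → Bool} {κ} {i j} c → i ≢ j → P (s , i) ≡ c → P (s , j) ≡ c →
  κ (s , j) ≡ not (κ (s , i)) → whites s P κ ≡ 𝟙 c + whites s (P without atPair i j) κ
whites-pair {n} s {P} {κ} {i} {j} c i≢j Pi≡c Pj≡c κj≡ =
  trans (whites-split s P κ (atPair i j)) (cong (_+ whites s (P without atPair i j) κ) pair-part)
  where
  f : Fin n → ℕ
  f k = 𝟙 ((P (s , k) ∧ κ (s , k)) ∧ atPair i j k)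
  outside : ∀ k → k ≢ i → k ≢ j → f k ≡ 0
  outside k k≢i k≢j with k ≟F i | k ≟F j
  ... | yes k≡i | _ = ⊥-elim (k≢i k≡i)
  ... | no _ | yes k≡j = ⊥-elim (k≢j k≡j)
  ... | no _ | no _ = cong 𝟙 (∧-zeroʳ _)
  at-i : atPair i j i ≡ true
  at-i with i ≟F i
  ... | yes _ = refl
  ... | no i≢i = ⊥-elim (i≢i refl)
  at-j : atPair i j j ≡ true
  at-j with j ≟F j
  ... | yes _ = ∨-zeroʳ _
  ... | no j≢j = ⊥-elim (j≢j refl)
  pair-part : ∑ (allFin n) f ≡ 𝟙 c
  pair-part = trans (∑-allFin-pair f i≢j outside) (trans
    (cong₂ _+_ (cong 𝟙 (trans (cong₂ (λ a b → (a ∧ κ (s , i)) ∧ b) Pi≡c at-i) (∧-identityʳ _)))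
               (cong 𝟙 (trans (cong₂ (λ a b → (a ∧ κ (s , j)) ∧ b) Pj≡c at-j) (trans (∧-identityʳ _) (cong (c ∧_) κj≡)))))
    (𝟙-split c (κ (s , i))))

atPair⁺ : ∀ {n} {i j k : Fin n} → k ≡ i ⊎ k ≡ j → T (atPair i j k)
atPair⁺ {i = i} {j} {k} (inj₁ refl) with k ≟F k
... | yes _ = _
... | no k≢k = ⊥-elim (k≢k refl)
atPair⁺ {i = i} {j} {k} (inj₂ refl) with k ≟F i | k ≟F k
... | yes _ | _ = _
... | no _ | yes _ = _
... | no _ | no k≢k = ⊥-elim (k≢k refl)

atPair⁻ : ∀ {n} {i j k : Fin n} → T (atPair i j k) → k ≡ i ⊎ k ≡ j
atPair⁻ {i = i} {j} {k} t with k ≟F i | k ≟F j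
... | yes k≡i | _ = inj₁ k≡i
... | no _ | yes k≡j = inj₂ k≡j

at : ∀ {n} → Fin n → Fin n → Bool
at h k = ⌊ k ≟F h ⌋

at⁺ : ∀ {n} {h k : Fin n} → k ≡ h → T (at h k)
at⁺ {h = h} {k} refl with k ≟F k
... | yes _ = _
... | no k≢k = ⊥-elim (k≢k refl)

at⁻ : ∀ {n} {h k : Fin n} → T (at h k) → k ≡ h
at⁻ {h = h} {k} t with k ≟F h
... | yes k≡h = k≡h

-- Every component is nearly balanced

∣𝟙-𝟙not∣≤1 : ∀ b → ∣ 𝟙 b - 𝟙 (not b) ∣ ≤ 1
∣𝟙-𝟙not∣≤1 true = s≤s z≤n
∣𝟙-𝟙not∣≤1 false = s≤s z≤n

module _ {n} {A : Fin n → Bool} {m : V n → V n} {κ : Coloring n}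
  (G : IsNoncrossingMatching A m) (K : IsColoring A m κ) where
  open IsNoncrossingMatching G
  open IsColoring K

  detach : (H : Fin n → Bool) (closed : ∀ x → active A x → T (H (height x)) → T (H (height (m x)))) →
    ∀ {i} → T (A i) → T (H i) →
    (∀ {v P} → active A v → T (H (height v)) → IsComponent A m v P → NearlyBalanced P κ) →
    ComponentsNearlyBalancedBelow A κ → ComponentsNearlyBalanced A m κ
  detach H closed Ai Hi inside smaller {v} {P} av comp with T-dec (H (height v))
  ... | inj₁ v∈ = inside av v∈ comp
  ... | inj₂ v∉ = smaller (activeCount-∖ {A = A} {H} Ai Hi) (∖-isNoncrossingMatching G ∖-preserves) (∖-isColoring K)
    (∉⇒∖ v av v∉) record
      { connected = λ Pz → Connected⇒∖ (connected Pz) av v∉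
      ; member = λ c → member (Connected-∖⇒ c)
      }
    where
    open IsComponent comp
    open Restriction H
    open Closed G closed

  module Through {p : V n} (ap : active A p) (mp≡ : m p ≡ across p) where

    closed : ∀ x → active A x → T (at (height p) (height x)) → T (at (height p) (height (m x)))
    closed x ax x∈ with vertex-at (proj₁ p) (height p) {x} (at⁻ x∈)
    ... | inj₁ refl = at⁺ (cong height mp≡)
    ... | inj₂ refl = at⁺ (cong height (trans (cong m (sym mp≡)) (involutive p ap)))

    inside : ∀ {v P} → active A v → T (at (height p) (height v)) → IsComponent A m v P → NearlyBalanced P κ
    inside {v} {P} av v∈ comp = subst₂ (λ a b → ∣ a - b ∣ ≤ 1)
      (sym (whites-at L P⊆h (Ph L))) (sym (trans (whites-at R P⊆h (Ph R)) (cong 𝟙 (flips-rung (L , height p)))))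
      (∣𝟙-𝟙not∣≤1 (κ (L , height p)))
      where
      open IsComponent comp
      open Restriction.Closed (at (height p)) G closed
      P⊆h : ∀ z → T (P z) → height z ≡ height p
      P⊆h z Pz = at⁻ (Connected-∈ (connected Pz) av v∈)
      Ph : ∀ s → T (P (s , height p))
      Ph s = member (Connected-same-height av (at⁻ v∈))

  module Cup (s : Side) {i j : Fin n} (ai : active A (s , i)) (mp≡ : m (s , i) ≡ (s , j)) (i≢j : i ≢ j) where

    aj : active A (s , j)
    aj = subst (active A) mp≡ (preserves (s , i) ai)

    mq≡p : m (s , j) ≡ (s , i)
    mq≡p = trans (cong m (sym mp≡)) (involutive (s , i) ai)

    alternates : ∀ s' → κ (s' , j) ≡ not (κ (s' , i))
    alternates s' with side-cases s s'
    ... | inj₁ refl = trans (cong κ (sym mp≡)) (flips-chord (s , i) ai)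
    ... | inj₂ refl = trans (flips-rung (s , j))
      (cong not (trans (trans (cong κ (sym mp≡)) (flips-chord (s , i) ai)) (sym (flips-rung (s , i)))))

    linked : ∀ z → height z ≡ i ⊎ height z ≡ j → Connected A m (s , i) z
    linked z (inj₁ z∈i) = Connected-same-height ai (sym z∈i)
    linked z (inj₂ z∈j) = subst (Connected A m (s , i)) mp≡ (chord ai ◅ ε) ◅◅ Connected-same-height aj (sym z∈j)

    component-constant : ∀ {v P} → IsComponent A m v P → ∀ z → height z ≡ i ⊎ height z ≡ j → P z ≡ P (s , i)
    component-constant comp z z∈ = T-⇔⇒≡
      (λ Pz → member (connected Pz ◅◅ Connected-sym G (linked z z∈)))
      (λ Pp → member (connected Pp ◅◅ linked z z∈))
      where open IsComponent comp

    whites-cup : ∀ {v P} → IsComponent A m v P → ∀ s' → whites s' P κ ≡ 𝟙 (P (s , i)) + whites s' (P without atPair i j) κ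
    whites-cup {P = P} comp s' = whites-pair s' {P} {κ} (P (s , i)) i≢j
      (component-constant comp (s' , i) (inj₁ refl)) (component-constant comp (s' , j) (inj₂ refl)) (alternates s')

    module Square (mirror≡ : m (flipSide s , i) ≡ (flipSide s , j)) where

      closed : ∀ x → active A x → T (atPair i j (height x)) → T (atPair i j (height (m x)))
      closed x ax x∈ with atPair⁻ x∈
      ... | inj₁ x∈i with vertex-at s i {x} x∈i
      ...   | inj₁ refl = atPair⁺ (inj₂ (cong height mp≡))
      ...   | inj₂ refl = atPair⁺ (inj₂ (cong height mirror≡))
      closed x ax x∈ | inj₂ x∈j with vertex-at s j {x} x∈j
      ...   | inj₁ refl = atPair⁺ (inj₁ (cong height mq≡p))
      ...   | inj₂ refl = atPair⁺ (inj₁ (cong height (trans (cong m (sym mirror≡)) (involutive (flipSide s , i) ai))))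

      inside : ∀ {v P} → active A v → T (atPair i j (height v)) → IsComponent A m v P → NearlyBalanced P κ
      inside {v} {P} av v∈ comp = subst₂ (λ a b → ∣ a - b ∣ ≤ 1) (sym (one L)) (sym (one R)) z≤n
        where
        open IsComponent comp
        open Restriction.Closed (atPair i j) G closed
        Pp : P (s , i) ≡ true
        Pp = T⇒≡true (member (Connected-sym G (linked v (atPair⁻ v∈))))
        outside-empty : ∀ z → ¬ T ((P without atPair i j) z)
        outside-empty z Pz∉ = T-not⁻ (T-∧⁻ʳ {P z} Pz∉) (Connected-∈ (connected (T-∧⁻ˡ {P z} Pz∉)) av v∈)
        one : ∀ s' → whites s' P κ ≡ 1
        one s' = trans (whites-cup comp s') (cong₂ _+_ (cong 𝟙 Pp) (whites-empty s' (P without atPair i j) κ outside-empty))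

module Contraction {n} {A : Fin n → Bool} {m : V n → V n} {κ : Coloring n}
  (G : IsNoncrossingMatching A m) (K : IsColoring A m κ)
  (s : Side) {i j : Fin n} (ai : active A (s , i)) (mp≡ : m (s , i) ≡ (s , j)) (i≢j : i ≢ j)
  (mirror-free : ∀ z → active A z → ¬ Between z (flipSide s , i) (flipSide s , j))
  (mirror≢ : m (flipSide s , i) ≢ (flipSide s , j)) where

  open IsNoncrossingMatching G
  open Cup G K s ai mp≡ i≢j

  p q u u' x y : V n
  p = s , i
  q = s , j
  u = flipSide s , i
  u' = flipSide s , j
  x = m u
  y = m u'

  H : Fin n → Bool
  H = atPair i j

  A' : Fin n → Bool
  A' = A ∖ H

  open Restriction {A = A} H using (∉⇒∖; ∖⇒active; ∖⇒∉; Connected-∖⇒)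

  u≢u' : u ≢ u'
  u≢u' u≡u' = i≢j (cong height u≡u')

  module RW = Rewiring G {u} {u'} ai aj u≢u' mirror-free mirror≢

  r : V n → V n
  r = RW.r

  in-H : ∀ z → height z ≡ i ⊎ height z ≡ j → T (H (height z))
  in-H z = atPair⁺

  -- The only chords leaving the four vertices at heights i, j are (u, x) and (u', y).
  m-into-H : ∀ z → active A z → T (H (height (m z))) → T (H (height z)) ⊎ (z ≡ x ⊎ z ≡ y)
  m-into-H z az mz∈ with atPair⁻ mz∈
  ... | inj₁ mz∈i with vertex-at s i {m z} mz∈i
  ...   | inj₁ mz≡p = inj₁ (in-H z (inj₂ (cong height (trans (sym (involutive z az)) (trans (cong m mz≡p) mp≡)))))
  ...   | inj₂ mz≡u = inj₂ (inj₁ (trans (sym (involutive z az)) (cong m mz≡u)))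
  m-into-H z az mz∈ | inj₂ mz∈j with vertex-at s j {m z} mz∈j
  ...   | inj₁ mz≡q = inj₁ (in-H z (inj₁ (cong height (trans (sym (involutive z az)) (trans (cong m mz≡q) mq≡p)))))
  ...   | inj₂ mz≡u' = inj₂ (inj₂ (trans (sym (involutive z az)) (cong m mz≡u')))

  x-off : ¬ T (H (height x))
  x-off x∈ with atPair⁻ x∈
  ... | inj₁ x∈i with vertex-at s i {x} x∈i
  ...   | inj₁ x≡p = i≢j (cong height (trans (sym (involutive u ai)) (trans (cong m x≡p) mp≡)))
  ...   | inj₂ x≡u = no-fixpoint u ai x≡u
  x-off x∈ | inj₂ x∈j with vertex-at s j {x} x∈j
  ...   | inj₁ x≡q = flipSide-≢ s (cong proj₁ (trans (sym (involutive u ai)) (trans (cong m x≡q) mq≡p)))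
  ...   | inj₂ x≡u' = mirror≢ x≡u'

  y-off : ¬ T (H (height y))
  y-off y∈ with atPair⁻ y∈
  ... | inj₁ y∈i with vertex-at s i {y} y∈i
  ...   | inj₁ y≡p = flipSide-≢ s (cong proj₁ (trans (sym (involutive u' aj)) (trans (cong m y≡p) mp≡)))
  ...   | inj₂ y≡u = mirror≢ (trans (cong m (sym y≡u)) (involutive u' aj))
  y-off y∈ | inj₂ y∈j with vertex-at s j {y} y∈j
  ...   | inj₁ y≡q = i≢j (sym (cong height (trans (sym (involutive u' aj)) (trans (cong m y≡q) mq≡p))))
  ...   | inj₂ y≡u' = no-fixpoint u' aj y≡u'

  x-active : active A' x
  x-active = ∉⇒∖ x (preserves u ai) x-off

  y-active : active A' y
  y-active = ∉⇒∖ y (preserves u' aj) y-off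

  r-preserves : ∀ z → active A' z → active A' (r z)
  r-preserves z az with RW.position z
  ... | RW.at-u = ⊥-elim (∖⇒∉ u az (in-H u (inj₁ refl)))
  ... | RW.at-u' = ⊥-elim (∖⇒∉ u' az (in-H u' (inj₂ refl)))
  ... | RW.at-a = subst (active A') (sym RW.r-a) y-active
  ... | RW.at-b = subst (active A') (sym RW.r-b) x-active
  ... | RW.elsewhere o@(_ , _ , z≢x , z≢y) =
    subst (active A') (sym (RW.r-other (∖⇒active z az) o)) (∉⇒∖ (m z) (preserves z (∖⇒active z az)) mz-off)
    where
    mz-off : ¬ T (H (height (m z)))
    mz-off mz∈ with m-into-H z (∖⇒active z az) mz∈
    ... | inj₁ z∈ = ∖⇒∉ z az z∈
    ... | inj₂ (inj₁ z≡x) = z≢x z≡x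
    ... | inj₂ (inj₂ z≡y) = z≢y z≡y

  contracted-isNoncrossingMatching : IsNoncrossingMatching A' r
  contracted-isNoncrossingMatching = Restriction.∖-isNoncrossingMatching H RW.isNoncrossingMatching r-preserves

  contracted-isColoring : IsColoring A' r κ
  contracted-isColoring = Restriction.∖-isColoring H (RW.isColoring K (alternates (flipSide s)))

  contracted-smaller : activeCount A' < activeCount A
  contracted-smaller = activeCount-∖ {A = A} {H} {i} ai (in-H p (inj₁ refl))

  -- The vertices at heights i and j collapse onto the ends x, y of the chords that leave them.
  squash : V n → V n
  squash z with height z ≟F i | height z ≟F j
  ... | yes _ | _ = x
  ... | no _ | yes _ = y
  ... | no _ | no _ = z

  squash-i : ∀ {z} → height z ≡ i → squash z ≡ x
  squash-i {z} z∈i with height z ≟F i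
  ... | yes _ = refl
  ... | no z∉i = ⊥-elim (z∉i z∈i)

  squash-j : ∀ {z} → height z ≡ j → squash z ≡ y
  squash-j {z} z∈j with height z ≟F i | height z ≟F j
  ... | yes z∈i | _ = ⊥-elim (i≢j (trans (sym z∈i) z∈j))
  ... | no _ | yes _ = refl
  ... | no _ | no z∉j = ⊥-elim (z∉j z∈j)

  squash-off : ∀ {z} → ¬ T (H (height z)) → squash z ≡ z
  squash-off {z} z∉ with height z ≟F i | height z ≟F j
  ... | yes _ | _ = ⊥-elim (z∉ _)
  ... | no _ | yes _ = ⊥-elim (z∉ _)
  ... | no _ | no _ = refl

  squash-H : ∀ {z z'} → T (H (height z)) → height z ≡ height z' → squash z ≡ squash z'
  squash-H {z} {z'} z∈ z≡z' with atPair⁻ z∈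
  ... | inj₁ z∈i = trans (squash-i {z} z∈i) (sym (squash-i {z'} (trans (sym z≡z') z∈i)))
  ... | inj₂ z∈j = trans (squash-j {z} z∈j) (sym (squash-j {z'} (trans (sym z≡z') z∈j)))

  squash-active : ∀ z → active A z → active A' (squash z)
  squash-active z az with T-dec (H (height z))
  ... | inj₂ z∉ = subst (active A') (sym (squash-off {z} z∉)) (∉⇒∖ z az z∉)
  ... | inj₁ z∈ with atPair⁻ z∈
  ...   | inj₁ z∈i = subst (active A') (sym (squash-i {z} z∈i)) x-active
  ...   | inj₂ z∈j = subst (active A') (sym (squash-j {z} z∈j)) y-active

  to-squash : ∀ z → active A z → Connected A m z (squash z)
  to-squash z az with T-dec (H (height z))
  ... | inj₂ z∉ = subst (Connected A m z) (sym (squash-off {z} z∉)) ε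
  ... | inj₁ z∈ with atPair⁻ z∈
  ...   | inj₁ z∈i = subst (Connected A m z) (sym (squash-i {z} z∈i)) (Connected-same-height {y = u} az z∈i ◅◅ chord ai ◅ ε)
  ...   | inj₂ z∈j = subst (Connected A m z) (sym (squash-j {z} z∈j)) (Connected-same-height {y = u'} az z∈j ◅◅ chord aj ◅ ε)

  x⇝y : Connected A m x y
  x⇝y = chord-to (preserves u ai) (involutive u ai) ◅◅ Connected-same-height {y = p} ai refl ◅◅ linked u' (inj₂ refl) ◅◅ chord aj ◅ ε

  back-step : ∀ {a b} → Step A' r a b → Connected A m a b
  back-step {a} (rung aa) = rung (∖⇒active a aa) ◅ ε
  back-step {a} (chord aa) with RW.position a
  ... | RW.at-u = ⊥-elim (∖⇒∉ u aa (in-H u (inj₁ refl)))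
  ... | RW.at-u' = ⊥-elim (∖⇒∉ u' aa (in-H u' (inj₂ refl)))
  ... | RW.at-a = subst (Connected A m x) (sym RW.r-a) x⇝y
  ... | RW.at-b = subst (Connected A m y) (sym RW.r-b) (Connected-sym G x⇝y)
  ... | RW.elsewhere o = chord-to (∖⇒active a aa) (sym (RW.r-other (∖⇒active a aa) o))

  fwd-step : ∀ {a b} → Step A m a b → Connected A' r (squash a) (squash b)
  fwd-step {a} (rung aa) with T-dec (H (height a))
  ... | inj₁ a∈ = subst (Connected A' r (squash a)) (squash-H {a} a∈ refl) ε
  ... | inj₂ a∉ = subst₂ (Connected A' r) (sym (squash-off {a} a∉)) (sym (squash-off {across a} a∉))
    (rung (∉⇒∖ a aa a∉) ◅ ε)
  fwd-step {a} (chord aa) with T-dec (H (height a))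
  ... | inj₁ a∈ with atPair⁻ a∈
  ...   | inj₁ a∈i with vertex-at s i {a} a∈i
  ...     | inj₁ refl = subst₂ (Connected A' r) (sym (squash-i {p} refl))
    (sym (trans (cong squash mp≡) (squash-j {q} refl))) (chord-to x-active RW.r-a)
  ...     | inj₂ refl = subst₂ (Connected A' r) (sym (squash-i {u} refl)) (sym (squash-off {x} x-off)) ε
  fwd-step {a} (chord aa) | inj₁ a∈ | inj₂ a∈j with vertex-at s j {a} a∈j
  ...     | inj₁ refl = subst₂ (Connected A' r) (sym (squash-j {q} refl))
    (sym (trans (cong squash mq≡p) (squash-i {p} refl))) (chord-to y-active RW.r-b)
  ...     | inj₂ refl = subst₂ (Connected A' r) (sym (squash-j {u'} refl)) (sym (squash-off {y} y-off)) ε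
  fwd-step {a} (chord aa) | inj₂ a∉ with T-dec (H (height (m a)))
  ... | inj₁ ma∈ with m-into-H a aa ma∈
  ...   | inj₁ a∈ = ⊥-elim (a∉ a∈)
  ...   | inj₂ (inj₁ refl) = subst₂ (Connected A' r) (sym (squash-off {x} x-off))
    (sym (trans (cong squash (involutive u ai)) (squash-i {u} refl))) ε
  ...   | inj₂ (inj₂ refl) = subst₂ (Connected A' r) (sym (squash-off {y} y-off))
    (sym (trans (cong squash (involutive u' aj)) (squash-j {u'} refl))) ε
  fwd-step {a} (chord aa) | inj₂ a∉ | inj₂ ma∉ =
    subst₂ (Connected A' r) (sym (squash-off {a} a∉)) (sym (squash-off {m a} ma∉))
      (chord-to (∉⇒∖ a aa a∉) (RW.r-other aa other))
    where
    off-≢ : ∀ {z w} → ¬ T (H (height z)) → T (H (height w)) → z ≢ w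
    off-≢ z∉ w∈ refl = z∉ w∈
    other : RW.Other a
    other = off-≢ a∉ (in-H u (inj₁ refl)) , off-≢ a∉ (in-H u' (inj₂ refl)) ,
      (λ a≡x → off-≢ ma∉ (in-H u (inj₁ refl)) (trans (cong m a≡x) (involutive u ai))) ,
      (λ a≡y → off-≢ ma∉ (in-H u' (inj₂ refl)) (trans (cong m a≡y) (involutive u' aj)))

  component : ∀ {v P} → active A v → IsComponent A m v P → IsComponent A' r (squash v) (P without H)
  component {v} {P} av comp = record { connected = forward ; member = backward }
    where
    open IsComponent comp
    forward : ∀ {z} → T ((P without H) z) → Connected A' r (squash v) z
    forward {z} Pz = subst (Connected A' r (squash v)) (squash-off {z} (T-not⁻ (T-∧⁻ʳ {P z} Pz)))
      (kleisliStar squash fwd-step (connected (T-∧⁻ˡ {P z} Pz)))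
    backward : ∀ {z} → Connected A' r (squash v) z → T ((P without H) z)
    backward {z} c = T-∧⁺ {P z} (member (to-squash v av ◅◅ kleisliStar (λ w → w) back-step c))
      (T-not⁺ (∖⇒∉ z (Connected-active contracted-isNoncrossingMatching (squash-active v av) c)))

  contract : ComponentsNearlyBalanced A' r κ → ComponentsNearlyBalanced A m κ
  contract rest {v} {P} av comp = subst₂ (λ a b → ∣ a - b ∣ ≤ 1) (sym (whites-cup comp L)) (sym (whites-cup comp R))
    (subst (_≤ 1) (sym (∣m+n-m+o∣≡∣n-o∣ (𝟙 (P p)) _ _)) (rest (squash-active v av) (component av comp)))

-- An innermost chord is a through strand, which is a component by itself, or a cup, which is
-- contracted (or detached together with its mirror cup, when that is a chord as well).
nearlyBalanced-step : ∀ {n} {A : Fin n → Bool} {m κ} → ComponentsNearlyBalancedBelow A κ →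
  IsNoncrossingMatching A m → IsColoring A m κ → ComponentsNearlyBalanced A m κ
nearlyBalanced-step {m = m} smaller G K {v} av comp with innermost G v av
... | p , ap , inner with shape G p ap inner
... | through mp≡ =
  detach G K (at (height p)) (Through.closed G K ap mp≡) ap (at⁺ refl) (Through.inside G K ap mp≡) smaller av comp
... | cup s {i} {j} refl mp≡ i≢j mirror-free with m (flipSide s , i) ≟V (flipSide s , j)
...   | yes mirror≡ = detach G K (atPair i j) Square.closed ap (atPair⁺ {i = i} {j} (inj₁ refl)) Square.inside smaller av comp
  where module Square = Cup.Square G K s ap mp≡ i≢j mirror≡
...   | no mirror≢ = contract (smaller contracted-smaller contracted-isNoncrossingMatching contracted-isColoring) av comp
  where open Contraction G K s ap mp≡ i≢j mirror-free mirror≢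

components-nearlyBalanced : ∀ f {n} {A : Fin n → Bool} {m κ} → activeCount A ≤ f →
  IsNoncrossingMatching A m → IsColoring A m κ → ComponentsNearlyBalanced A m κ
components-nearlyBalanced zero {A = A} bound _ _ {v} av _ with ≤-trans (activeCount-pos {A = A} {v} av) bound
... | ()
components-nearlyBalanced (suc f) bound =
  nearlyBalanced-step (λ smaller → components-nearlyBalanced f (≤-pred (<-≤-trans smaller bound)))

-- Reachability in τ̂ and representatives of its cycles

module _ {n} (m : V n → V n) where

  reach-sound : ∀ k {x y} → T (reach m k x y) → Connected (const true) m x y
  reach-sound zero {x} t = subst (Connected (const true) m x) (==V-sound t) ε
  reach-sound (suc k) {x} {y} t with T-∨⁻ {reach m k x y} t
  ... | inj₁ t' = reach-sound k t'
  ... | inj₂ t' with T-∨⁻ {reach m k (m x) y} t'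
  ...   | inj₁ t'' = chord tt ◅ reach-sound k t''
  ...   | inj₂ t'' = rung tt ◅ reach-sound k t''

  reach-suc : ∀ k {x y} → T (reach m k x y) → T (reach m (suc k) x y)
  reach-suc k = T-∨⁺ˡ

  reach-+ : ∀ d k {x y} → T (reach m k x y) → T (reach m (d + k) x y)
  reach-+ zero k t = t
  reach-+ (suc d) k t = reach-suc (d + k) (reach-+ d k t)

  reach-complete : ∀ {x y} → Connected (const true) m x y → Σ[ k ∈ ℕ ] T (reach m k x y)
  reach-complete {x} ε = 0 , T-==V-refl x
  reach-complete {x} {y} (chord _ ◅ c) with reach-complete c
  ... | k , t = suc k , T-∨⁺ʳ {reach m k x y} (T-∨⁺ˡ t)
  reach-complete {x} {y} (rung _ ◅ c) with reach-complete c
  ... | k , t = suc k , T-∨⁺ʳ {reach m k x y} (T-∨⁺ʳ {reach m k (m x) y} t)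

  -- For a fixed target y, reach m (suc k) · y is obtained from reach m k · y by one closure step, so
  -- once the set stops growing it is stable; it can only grow 2n times.
  module Toward (y : V n) where

    count : ℕ → ℕ
    count k = ∑[ w ∈ vertices n ] 𝟙 (reach m k w y)

    Stable : ℕ → Set
    Stable k = ∀ w → T (reach m (suc k) w y) → T (reach m k w y)

    stable-suc : ∀ k → Stable k → Stable (suc k)
    stable-suc k st w t with T-∨⁻ {reach m (suc k) w y} t
    ... | inj₁ t' = T-∨⁺ˡ (st w t')
    ... | inj₂ t' with T-∨⁻ {reach m (suc k) (m w) y} t'
    ...   | inj₁ t'' = T-∨⁺ʳ {reach m k w y} (T-∨⁺ˡ (st (m w) t''))
    ...   | inj₂ t'' = T-∨⁺ʳ {reach m k w y} (T-∨⁺ʳ {reach m k (m w) y} (st (across w) t''))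

    stable-if-not-growing : ∀ k → count (suc k) ≤ count k → Stable k
    stable-if-not-growing k not-growing w t with T-dec (reach m k w y)
    ... | inj₁ t' = t'
    ... | inj₂ ¬t' = ⊥-elim (<-irrefl refl (<-≤-trans
      (∑-mono-< (vertices n) (λ w' → 𝟙-mono (reach-suc k {w'} {y})) (∈-vertices w) (𝟙-< ¬t' t)) not-growing))

    growth : ∀ k → Stable k ⊎ suc k ≤ count k
    growth zero = inj₂ (subst (_≤ count 0) (cong 𝟙 (==V-refl y)) (term≤∑ (vertices n) (λ w → 𝟙 (reach m 0 w y)) (∈-vertices y)))
    growth (suc k) with growth k
    ... | inj₁ st = inj₁ (stable-suc k st)
    ... | inj₂ grown with count (suc k) ≤? count k
    ...   | yes not-growing = inj₁ (stable-suc k (stable-if-not-growing k not-growing))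
    ...   | no growing = inj₂ (≤-trans (s≤s grown) (≰⇒> growing))

    stable-beyond : ∀ d → Stable (d + (n + n))
    stable-beyond zero with growth (n + n)
    ... | inj₁ st = st
    ... | inj₂ grown = ⊥-elim (<-irrefl refl (<-≤-trans grown (∑-𝟙≤vertices (λ w → reach m (n + n) w y))))
    stable-beyond (suc d) = stable-suc (d + (n + n)) (stable-beyond d)

    collapse : ∀ d w → T (reach m (d + (n + n)) w y) → T (reach m (n + n) w y)
    collapse zero w t = t
    collapse (suc d) w t = collapse d w (stable-beyond d w t)

  conn-complete : ∀ {x y} → Connected (const true) m x y → T (conn m x y)
  conn-complete {x} {y} c with reach-complete c
  ... | k , t = Toward.collapse y k x (subst (λ k' → T (reach m k' x y)) (+-comm (n + n) k) (reach-+ (n + n) k t))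

allB-sound : ∀ {A : Set} (p : A → Bool) xs → T (allB p xs) → ∀ a → a ∈ xs → T (p a)
allB-sound p (b ∷ xs) t a (here refl) = T-∧⁻ˡ {p a} t
allB-sound p (b ∷ xs) t a (there a∈) = allB-sound p xs (T-∧⁻ʳ {p b} t) a a∈

allB-counterexample : ∀ {A : Set} (p : A → Bool) xs → ¬ T (allB p xs) → Σ[ a ∈ A ] a ∈ xs × ¬ T (p a)
allB-counterexample p [] ¬t = ⊥-elim (¬t tt)
allB-counterexample p (b ∷ xs) ¬t with T-dec (p b)
... | inj₂ ¬pb = b , here refl , ¬pb
... | inj₁ pb with allB-counterexample p xs (λ t → ¬t (T-∧⁺ {p b} pb t))
...   | a , a∈ , ¬pa = a , there a∈ , ¬pa

principal⇒isColoring : ∀ {n} {τ : Diagram n} {κ} → Principal τ κ → IsColoring (const true) τ κ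
principal⇒isColoring (chords , rungs) = record
  { flips-chord = λ x _ → sym (chords x) ; flips-rung = λ x → sym (rungs x) }

module Components {n} {τ : Diagram n} (τ∈ : InB n τ) where

  G : IsNoncrossingMatching (const true) τ
  G = InB-isNoncrossingMatching τ∈

  conn⇒ : ∀ {x y} → T (conn τ x y) → Connected (const true) τ x y
  conn⇒ = reach-sound τ (n + n)

  ⇒conn : ∀ {x y} → Connected (const true) τ x y → T (conn τ x y)
  ⇒conn = conn-complete τ

  conn-isComponent : ∀ x → IsComponent (const true) τ x (conn τ x)
  conn-isComponent x = record { connected = conn⇒ ; member = ⇒conn }

  conn-sym : ∀ {x y} → T (conn τ x y) → T (conn τ y x)
  conn-sym c = ⇒conn (Connected-sym G (conn⇒ c))

  conn-trans : ∀ {x y z} → T (conn τ x y) → T (conn τ y z) → T (conn τ x z)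
  conn-trans c d = ⇒conn (conn⇒ c ◅◅ conn⇒ d)

  conn-across : ∀ x k → conn τ x (R , k) ≡ conn τ x (L , k)
  conn-across x k = T-⇔⇒≡ (λ c → conn-trans c (⇒conn (rung tt ◅ ε))) (λ c → conn-trans c (⇒conn (rung tt ◅ ε)))

  nearlyBalanced : ∀ {κ} → Principal τ κ → ∀ x → ∣ whiteL τ κ x - whiteR τ κ x ∣ ≤ 1
  nearlyBalanced pr x = components-nearlyBalanced _ ≤-refl G (principal⇒isColoring pr) tt (conn-isComponent x)

  representative-minimal : ∀ {x} → T (isRep τ x) → ∀ {z} → T (conn τ z x) → code x ≤ code z
  representative-minimal {x} rep {z} c with T-∨⁻ (allB-sound _ (vertices n) rep z (∈-vertices z))
  ... | inj₁ ¬c = ⊥-elim (T-not⁻ ¬c c)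
  ... | inj₂ x≤z = ≤ᵇ⇒≤ (code x) (code z) x≤z

  representative-below : ∀ k y w → code w < k → T (conn τ w y) → Σ[ x ∈ V n ] T (isRep τ x ∧ conn τ x y)
  representative-below (suc k) y w w<k c with T-dec (isRep τ w)
  ... | inj₁ rep = w , T-∧⁺ {isRep τ w} rep c
  ... | inj₂ ¬rep with allB-counterexample _ (vertices n) ¬rep
  ...   | a , _ , ¬p = representative-below k y a (<-≤-trans a<w (≤-pred w<k)) (conn-trans a~w c)
    where
    a~w : T (conn τ a w)
    a~w with T-dec (conn τ a w)
    ... | inj₁ t = t
    ... | inj₂ ¬t = ⊥-elim (¬p (T-∨⁺ˡ (T-not⁺ ¬t)))
    a<w : code a < code w
    a<w = ≰⇒> (λ w≤a → ¬p (T-∨⁺ʳ {not (conn τ a w)} (≤⇒≤ᵇ w≤a)))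

  one-representative : ∀ y → ∑[ x ∈ vertices n ] 𝟙 (isRep τ x ∧ conn τ x y) ≡ 1
  one-representative y with representative-below (suc (code y)) y y ≤-refl (⇒conn ε)
  ... | z , t = trans (∑-vertices-point _ z unique) (cong 𝟙 (T⇒≡true t))
    where
    unique : ∀ w → w ≢ z → 𝟙 (isRep τ w ∧ conn τ w y) ≡ 0
    unique w w≢z with T-dec (isRep τ w ∧ conn τ w y)
    ... | inj₂ ¬t = cong 𝟙 (¬T⇒≡false ¬t)
    ... | inj₁ t' = ⊥-elim (w≢z (code-injective (≤-antisym
      (representative-minimal (T-∧⁻ˡ {isRep τ w} t') (conn-trans (T-∧⁻ʳ {isRep τ z} t) (conn-sym (T-∧⁻ʳ {isRep τ w} t'))))
      (representative-minimal (T-∧⁻ˡ {isRep τ z} t) (conn-trans (T-∧⁻ʳ {isRep τ w} t') (conn-sym (T-∧⁻ʳ {isRep τ z} t)))))))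

  ∑-over-representatives : ∀ (Q : V n → Bool) →
    ∑[ x ∈ vertices n ] (𝟙 (isRep τ x) * countB (λ y → conn τ x y ∧ Q y) (vertices n)) ≡ countB Q (vertices n)
  ∑-over-representatives Q = begin
    ∑[ x ∈ vertices n ] (𝟙 (isRep τ x) * countB (λ y → conn τ x y ∧ Q y) (vertices n))
      ≡⟨ ∑-cong (vertices n) (λ x _ → trans (cong (𝟙 (isRep τ x) *_) (∑-countB _ (vertices n)))
                                           (∑-*ˡ (𝟙 (isRep τ x)) (vertices n) (λ y → 𝟙 (conn τ x y ∧ Q y)))) ⟩
    ∑[ x ∈ vertices n ] ∑[ y ∈ vertices n ] (𝟙 (isRep τ x) * 𝟙 (conn τ x y ∧ Q y))
      ≡⟨ ∑-cong (vertices n) (λ x _ → ∑-cong (vertices n) (λ y _ → 𝟙-rearrange (isRep τ x) (conn τ x y) (Q y))) ⟩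
    ∑[ x ∈ vertices n ] ∑[ y ∈ vertices n ] (𝟙 (Q y) * 𝟙 (isRep τ x ∧ conn τ x y))
      ≡⟨ ∑-comm (vertices n) (vertices n) _ ⟩
    ∑[ y ∈ vertices n ] ∑[ x ∈ vertices n ] (𝟙 (Q y) * 𝟙 (isRep τ x ∧ conn τ x y))
      ≡⟨ ∑-cong (vertices n) (λ y _ → trans (sym (∑-*ˡ (𝟙 (Q y)) (vertices n) _))
                                           (trans (cong (𝟙 (Q y) *_) (one-representative y)) (*-identityʳ _))) ⟩
    ∑[ y ∈ vertices n ] 𝟙 (Q y)
      ≡⟨ ∑-countB Q (vertices n) ⟨
    countB Q (vertices n) ∎
    where
    open ≡-Reasoning
    𝟙-rearrange : ∀ r c q → 𝟙 r * 𝟙 (c ∧ q) ≡ 𝟙 q * 𝟙 (r ∧ c)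
    𝟙-rearrange true true true = refl
    𝟙-rearrange true true false = refl
    𝟙-rearrange true false q = sym (*-zeroʳ (𝟙 q))
    𝟙-rearrange false c q = sym (*-zeroʳ (𝟙 q))

-- Counting α and β

n<ᵇn : ∀ a → (a <ᵇ a) ≡ false
n<ᵇn zero = refl
n<ᵇn (suc a) = n<ᵇn a

n<ᵇ1+n : ∀ a → (a <ᵇ suc a) ≡ true
n<ᵇ1+n zero = refl
n<ᵇ1+n (suc a) = n<ᵇ1+n a

1+n<ᵇn : ∀ a → (suc a <ᵇ a) ≡ false
1+n<ᵇn zero = refl
1+n<ᵇn (suc a) = 1+n<ᵇn a

∣-∣≤1-cases : ∀ a b → ∣ a - b ∣ ≤ 1 → a ≡ b ⊎ b ≡ suc a ⊎ a ≡ suc b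
∣-∣≤1-cases zero zero _ = inj₁ refl
∣-∣≤1-cases zero (suc zero) _ = inj₂ (inj₁ refl)
∣-∣≤1-cases zero (suc (suc b)) (s≤s ())
∣-∣≤1-cases (suc zero) zero _ = inj₂ (inj₂ refl)
∣-∣≤1-cases (suc (suc a)) zero (s≤s ())
∣-∣≤1-cases (suc a) (suc b) d with ∣-∣≤1-cases a b d
... | inj₁ a≡b = inj₁ (cong suc a≡b)
... | inj₂ (inj₁ b≡1+a) = inj₂ (inj₁ (cong suc b≡1+a))
... | inj₂ (inj₂ a≡1+b) = inj₂ (inj₂ (cong suc a≡1+b))

[n+n]%2≡0 : ∀ a → (a + a) % 2 ≡ 0
[n+n]%2≡0 a = trans (cong (_% 2) (trans (cong (a +_) (sym (+-identityʳ a))) (*-comm 2 a))) (m*n%n≡0 a 2)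

[n+1+n]%2≡1 : ∀ a → (a + suc a) % 2 ≡ 1
[n+1+n]%2≡1 a = trans (cong (_% 2) (trans (+-suc a a) (cong suc (trans (cong (a +_) (sym (+-identityʳ a))) (*-comm 2 a)))))
  ([m+kn]%n≡m%n 1 a 2)

lean-shift : ∀ a b → ∣ a - b ∣ ≤ 1 → 𝟙 (b <ᵇ a) + b ≡ 𝟙 (a <ᵇ b) + a
lean-shift a b d with ∣-∣≤1-cases a b d
... | inj₁ refl = refl
... | inj₂ (inj₁ refl) rewrite 1+n<ᵇn a | n<ᵇ1+n a = refl
... | inj₂ (inj₂ refl) rewrite 1+n<ᵇn b | n<ᵇ1+n b = refl

lean-parity : ∀ a b → ∣ a - b ∣ ≤ 1 → 𝟙 (a <ᵇ b) + 𝟙 (b <ᵇ a) ≡ (a + b) % 2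
lean-parity a b d with ∣-∣≤1-cases a b d
... | inj₁ refl rewrite n<ᵇn a = sym ([n+n]%2≡0 a)
... | inj₂ (inj₁ refl) rewrite 1+n<ᵇn a | n<ᵇ1+n a = sym ([n+1+n]%2≡1 a)
... | inj₂ (inj₂ refl) rewrite 1+n<ᵇn b | n<ᵇ1+n b = sym (trans (cong (_% 2) (+-comm (suc b) b)) ([n+1+n]%2≡1 b))

whites-L+R : ∀ {n} (P : V n → Bool) κ → (∀ k → P (R , k) ≡ P (L , k)) → (∀ k → κ (R , k) ≡ not (κ (L , k))) →
  whites L P κ + whites R P κ ≡ ∑[ k ∈ allFin n ] 𝟙 (P (L , k))
whites-L+R {n} P κ P-across κ-across = begin
  whites L P κ + whites R P κ
    ≡⟨ cong₂ _+_ (whites-∑ L P κ) (whites-∑ R P κ) ⟩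
  ∑[ k ∈ allFin n ] 𝟙 (P (L , k) ∧ κ (L , k)) + ∑[ k ∈ allFin n ] 𝟙 (P (R , k) ∧ κ (R , k))
    ≡⟨ ∑-+ (allFin n) _ _ ⟨
  ∑[ k ∈ allFin n ] (𝟙 (P (L , k) ∧ κ (L , k)) + 𝟙 (P (R , k) ∧ κ (R , k)))
    ≡⟨ ∑-cong (allFin n) (λ k _ → trans (cong (λ b → 𝟙 (P (L , k) ∧ κ (L , k)) + 𝟙 b)
         (cong₂ _∧_ (P-across k) (κ-across k))) (𝟙-split (P (L , k)) (κ (L , k)))) ⟩
  ∑[ k ∈ allFin n ] 𝟙 (P (L , k)) ∎
  where open ≡-Reasoning

whiteRight : ∀ {n} → Coloring n → ℕ
whiteRight {n} κ = countB (λ y → isR y ∧ κ y) (vertices n)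

∑-*-+ : ∀ {A : Set} xs (c f g : A → ℕ) → ∑[ x ∈ xs ] (c x * f x) + ∑[ x ∈ xs ] (c x * g x) ≡ ∑[ x ∈ xs ] (c x * (f x + g x))
∑-*-+ xs c f g = trans (sym (∑-+ xs _ _)) (∑-cong xs (λ x _ → sym (*-distribˡ-+ (c x) (f x) (g x))))

module Imbalance {n} {τ : Diagram n} (τ∈ : InB n τ) where
  open Components τ∈

  rep : V n → ℕ
  rep x = 𝟙 (isRep τ x)

  heights : V n → ℕ
  heights x = ∑[ k ∈ allFin n ] 𝟙 (conn τ x (L , k))

  oddComponents : ℕ
  oddComponents = ∑[ x ∈ vertices n ] (rep x * (heights x % 2))

  countB-representatives : ∀ (f : V n → Bool) → countB (λ x → isRep τ x ∧ f x) (vertices n) ≡ ∑[ x ∈ vertices n ] (rep x * 𝟙 (f x))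
  countB-representatives f = trans (∑-countB _ (vertices n)) (∑-cong (vertices n) (λ x _ → 𝟙-∧ (isRep τ x) (f x)))

  module _ {κ} (pr : Principal τ κ) where

    wl wr leans-right leans-left : V n → ℕ
    wl = whiteL τ κ
    wr = whiteR τ κ
    leans-right x = 𝟙 (wl x <ᵇ wr x)
    leans-left x = 𝟙 (wr x <ᵇ wl x)

    κ-across : ∀ k → κ (R , k) ≡ not (κ (L , k))
    κ-across k = sym (proj₂ pr (L , k))

    whiteLeft+whiteRight : whiteLeft κ + whiteRight κ ≡ n
    whiteLeft+whiteRight =
      trans (whites-L+R (λ _ → true) κ (λ _ → refl) κ-across) (trans (∑-allFin-const n 1) (*-identityʳ n))

    α+β : α τ κ + β τ κ ≡ oddComponents
    α+β = begin
      α τ κ + β τ κ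
        ≡⟨ cong₂ _+_ (countB-representatives (λ x → wl x <ᵇ wr x)) (countB-representatives (λ x → wr x <ᵇ wl x)) ⟩
      ∑[ x ∈ vertices n ] (rep x * leans-right x) + ∑[ x ∈ vertices n ] (rep x * leans-left x)
        ≡⟨ ∑-*-+ (vertices n) rep leans-right leans-left ⟩
      ∑[ x ∈ vertices n ] (rep x * (leans-right x + leans-left x))
        ≡⟨ ∑-cong (vertices n) (λ x _ → cong (rep x *_) (trans (lean-parity (wl x) (wr x) (nearlyBalanced pr x))
             (cong (_% 2) (whites-L+R (conn τ x) κ (conn-across x) κ-across)))) ⟩
      oddComponents ∎
      where open ≡-Reasoning

    β+whiteRight : β τ κ + whiteRight κ ≡ α τ κ + whiteLeft κ
    β+whiteRight = begin
      β τ κ + whiteRight κ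
        ≡⟨ cong₂ _+_ (countB-representatives (λ x → wr x <ᵇ wl x)) (sym (∑-over-representatives (λ y → isR y ∧ κ y))) ⟩
      ∑[ x ∈ vertices n ] (rep x * leans-left x) + ∑[ x ∈ vertices n ] (rep x * wr x)
        ≡⟨ ∑-*-+ (vertices n) rep leans-left wr ⟩
      ∑[ x ∈ vertices n ] (rep x * (leans-left x + wr x))
        ≡⟨ ∑-cong (vertices n) (λ x _ → cong (rep x *_) (lean-shift (wl x) (wr x) (nearlyBalanced pr x))) ⟩
      ∑[ x ∈ vertices n ] (rep x * (leans-right x + wl x))
        ≡⟨ ∑-*-+ (vertices n) rep leans-right wl ⟨
      ∑[ x ∈ vertices n ] (rep x * leans-right x) + ∑[ x ∈ vertices n ] (rep x * wl x)
        ≡⟨ cong₂ _+_ (countB-representatives (λ x → wl x <ᵇ wr x)) (sym (∑-over-representatives (λ y → isL y ∧ κ y))) ⟨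
      α τ κ + whiteLeft κ ∎
      where open ≡-Reasoning

    twice-β : 2 * β τ κ + whiteRight κ ≡ oddComponents + whiteLeft κ
    twice-β = begin
      2 * β τ κ + whiteRight κ        ≡⟨ cong (λ b → β τ κ + b + whiteRight κ) (+-identityʳ (β τ κ)) ⟩
      β τ κ + β τ κ + whiteRight κ    ≡⟨ +-assoc (β τ κ) _ _ ⟩
      β τ κ + (β τ κ + whiteRight κ)  ≡⟨ cong (β τ κ +_) β+whiteRight ⟩
      β τ κ + (α τ κ + whiteLeft κ)   ≡⟨ +-assoc (β τ κ) _ _ ⟨
      β τ κ + α τ κ + whiteLeft κ     ≡⟨ cong (_+ whiteLeft κ) (trans (+-comm (β τ κ) (α τ κ)) α+β) ⟩
      oddComponents + whiteLeft κ     ∎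
      where open ≡-Reasoning

lemma4p2 : (n : ℕ) → 1 ≤ n → (τ : Diagram n) → InB n τ →
    (j : ℕ) → j ≤ n / 2 →
    (κ κ' : Coloring n) → Principal τ κ → Principal τ κ' →
    whiteLeft κ ≡ j → whiteLeft κ' ≡ j →
    (α τ κ ≡ α τ κ') × (β τ κ ≡ β τ κ')
lemma4p2 n _ τ τ∈ j _ κ κ' pr pr' κ-left κ'-left = α-equal , β-equal
  where
  open Imbalance τ∈
  same-left : whiteLeft κ ≡ whiteLeft κ'
  same-left = trans κ-left (sym κ'-left)
  same-right : whiteRight κ ≡ whiteRight κ'
  same-right = +-cancelˡ-≡ (whiteLeft κ) _ _
    (trans (whiteLeft+whiteRight pr) (sym (trans (cong (_+ whiteRight κ') same-left) (whiteLeft+whiteRight pr'))))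
  β-equal : β τ κ ≡ β τ κ'
  β-equal = *-cancelˡ-≡ _ _ 2 (+-cancelʳ-≡ (whiteRight κ) _ _
    (trans (twice-β pr) (trans (cong (oddComponents +_) same-left)
      (trans (sym (twice-β pr')) (cong (2 * β τ κ' +_) (sym same-right))))))
  α-equal : α τ κ ≡ α τ κ'
  α-equal = +-cancelʳ-≡ (β τ κ) _ _ (trans (α+β pr) (trans (sym (α+β pr')) (cong (α τ κ' +_) (sym β-equal))))
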